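{- For every sufficiently large $n$, there exists a drawing of a graph $G$ with $n$ vertices and $O(n)$ edges such that every casing of the drawing has $\Omega(n^2)$ switches.
   Context: A drawing places vertices at distinct points and edges as straight segments, such that no vertex lies on an edge unless it is an endpoint of it, no more than two edges cross in one point, and crossings are far enough apart to be treated independently. A casing chooses independently at each crossing which of the two edges is on top; the crossing is a bridge for the top edge and a tunnel for the other. A switch is a pair of consecutive crossings along an edge $e$ with one a bridge and the other a tunnel for $e$. The $O(\cdot)$ and $\Omega(\cdot)$ bounds are with constants independent of $n$. -}

module Defs where

open import Data.Bool using (Bool; true; false; not; _∧_; _∨_; _xor_; if_then_else_)
open import Data.Nat as ℕ using (ℕ)
open import Data.Integer as ℤ using (ℤ; _-_; _*_; +_; ∣_∣)
open import Data.Fin using (Fin) renaming (_<?_ to _<ᶠ?_)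
open import Data.Fin.Properties using () renaming (_≟_ to _≟ᶠ_)
open import Data.List using (List; map; allFin)
open import Data.Bool.ListAction using (and)
open import Data.Nat.ListAction using (sum)
open import Data.Product using (_×_; _,_)
open import Data.Sum using (_⊎_)
open import Relation.Nullary using (¬_)
open import Relation.Nullary.Decidable using (⌊_⌋)
open import Relation.Binary.PropositionalEquality using (_≡_; _≢_)

Point : Set
Point = ℤ × ℤ

-- Twice the signed area of the triangle p q r (orientation test).
orient : Point → Point → Point → ℤ
orient (px , py) (qx , qy) (rx , ry) =
  (qx - px) * (ry - py) - (qy - py) * (rx - px)

-- (v - a)·(v - b); for v collinear with a, b, v is on segment ab iff ≤ 0.
dotAt : Point → Point → Point → ℤ
dotAt (ax , ay) (bx , by) (vx , vy) =
  (vx - ax) * (vx - bx) ℤ.+ (vy - ay) * (vy - by)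

properCross : Point → Point → Point → Point → Bool
properCross a b c d =
  ⌊ (orient a b c * orient a b d) ℤ.<? + 0 ⌋ ∧
  ⌊ (orient c d a * orient c d b) ℤ.<? + 0 ⌋

-- A straight-line placement of a graph with vertex set Fin n and m edges;
-- edge i is the segment from vertex src i to vertex tgt i.
record Layout (n m : ℕ) : Set where
  field
    pos : Fin n → Point
    src : Fin m → Fin n
    tgt : Fin m → Fin n

module _ {n m : ℕ} (L : Layout n m) where
  open Layout L

  P₁ P₂ : Fin m → Point
  P₁ i = pos (src i)
  P₂ i = pos (tgt i)

  crosses : Fin m → Fin m → Bool
  crosses i j = properCross (P₁ i) (P₂ i) (P₁ j) (P₂ j)

  -- Position along edge e of its crossing with f, as the fraction
  -- num / den of the way from src e to tgt e (meaningful when they cross).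
  num den : Fin m → Fin m → ℕ
  num e f = ∣ orient (P₁ f) (P₂ f) (P₁ e) ∣
  den e f = ∣ orient (P₁ f) (P₂ f) (P₁ e) ∣ ℕ.+ ∣ orient (P₁ f) (P₂ f) (P₂ e) ∣

  before : Fin m → Fin m → Fin m → Bool
  before e f g = ⌊ (num e f ℕ.* den e g) ℕ.<? (num e g ℕ.* den e f) ⌋

  record IsDrawing : Set where
    field
      noLoop  : ∀ i → src i ≢ tgt i
      noMulti : ∀ i j → i ≢ j →
        ¬ ((src i ≡ src j × tgt i ≡ tgt j) ⊎ (src i ≡ tgt j × tgt i ≡ src j))
      posInj : ∀ u v → pos u ≡ pos v → u ≡ v
      -- no vertex lies on an edge unless it is an endpoint of it
      noVertexOnEdge : ∀ v i → v ≢ src i → v ≢ tgt i →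
        orient (P₁ i) (P₂ i) (pos v) ≡ + 0 →
        + 0 ℤ.< dotAt (P₁ i) (P₂ i) (pos v)
      -- no more than two edges cross in one point: two distinct edges
      -- crossing e do so at distinct points of e
      noTripleCrossing : ∀ e f g → f ≢ g →
        crosses e f ≡ true → crosses e g ≡ true →
        num e f ℕ.* den e g ≢ num e g ℕ.* den e f

  -- A casing: for each pair i < j of edges, κ i j says whether i is on top.
  Casing : Set
  Casing = Fin m → Fin m → Bool

  onTop : Casing → Fin m → Fin m → Bool
  onTop κ e f = if ⌊ e <ᶠ? f ⌋ then κ e f else not (κ f e)

  consecutive : Fin m → Fin m → Fin m → Bool
  consecutive e f g = and (map (λ h → not (crosses e h ∧
      ((before e f h ∧ before e h g) ∨ (before e g h ∧ before e h f))))
    (allFin m))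

  isSwitch : Casing → Fin m → Fin m → Fin m → Bool
  isSwitch κ e f g = ⌊ f <ᶠ? g ⌋ ∧ crosses e f ∧ crosses e g ∧
    consecutive e f g ∧ (onTop κ e f xor onTop κ e g)

  toℕ' : Bool → ℕ
  toℕ' true = 1
  toℕ' false = 0

  ΣFin : (Fin m → ℕ) → ℕ
  ΣFin h = sum (map h (allFin m))

  switches : Casing → ℕ
  switches κ = ΣFin λ e → ΣFin λ f → ΣFin λ g → toℕ' (isSwitch κ e f g)

module Submission where

-- For n ≥ 24 we draw 6k ≤ n edges (k = 2⌊n/24⌋) between the lines y = 0 and
-- y = 1: k vertical ones (type V), k leaning right by E = 8k (type Q) and 4k
-- leaning left by E (type R).  Endpoint x-coordinates are 4p + code(type), so
-- along an edge the crossing with an edge of another type lies at n/(E·gap),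
-- where the parity of n is fixed by the two types; with parallelism of equal
-- types this rules out triple crossings.  For every pair a, b < k/2 one edge
-- of each type forms a triangle: the three cross pairwise, and along each of
-- them the two crossings are consecutive, since over a common denominator
-- their positions are adjacent integers.  Every casing of a triangle has a
-- switch, from which (a, b) can be decoded; a counting principle for finite
-- sums then gives (k/2)² ≥ n²/2304 switches.

module FinSums where

  open import Data.Nat
  open import Data.Nat.Properties
  open import Data.Fin using (Fin; zero; suc; toℕ)
  open import Data.List using (map; tabulate; allFin)
  open import Data.List.Properties using (map-tabulate)
  open import Data.Nat.ListAction using (sum)
  open import Data.Bool using (true; if_then_else_)
  open import Data.Bool.Properties using (T-≡)
  open import Data.Product using (_×_; _,_; proj₁; proj₂)
  open import Function using (id; _∘_; Equivalence)
  open import Relation.Binary.PropositionalEquality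
  open import Algebra.Properties.CommutativeSemigroup +-commutativeSemigroup using (interchange)

  ∑ : (m : ℕ) → (Fin m → ℕ) → ℕ
  ∑ m h = sum (tabulate h)

  sum-allFin : ∀ m (h : Fin m → ℕ) → sum (map h (allFin m)) ≡ ∑ m h
  sum-allFin m h = cong sum (map-tabulate id h)

  ∑-cong : ∀ m {f g : Fin m → ℕ} → (∀ x → f x ≡ g x) → ∑ m f ≡ ∑ m g
  ∑-cong zero    eq = refl
  ∑-cong (suc m) eq = cong₂ _+_ (eq zero) (∑-cong m (eq ∘ suc))

  ∑-mono : ∀ m {f g : Fin m → ℕ} → (∀ x → f x ≤ g x) → ∑ m f ≤ ∑ m g
  ∑-mono zero    le = z≤n
  ∑-mono (suc m) le = +-mono-≤ (le zero) (∑-mono m (le ∘ suc))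

  ∑-const : ∀ m c → ∑ m (λ _ → c) ≡ m * c
  ∑-const zero    c = refl
  ∑-const (suc m) c = cong (c +_) (∑-const m c)

  ∑-+ : ∀ m (f g : Fin m → ℕ) → ∑ m (λ x → f x + g x) ≡ ∑ m f + ∑ m g
  ∑-+ zero    f g = refl
  ∑-+ (suc m) f g = begin
      (f zero + g zero) + ∑ m (λ x → f (suc x) + g (suc x))
    ≡⟨ cong ((f zero + g zero) +_) (∑-+ m (f ∘ suc) (g ∘ suc)) ⟩
      (f zero + g zero) + (∑ m (f ∘ suc) + ∑ m (g ∘ suc))
    ≡⟨ interchange (f zero) (g zero) (∑ m (f ∘ suc)) (∑ m (g ∘ suc)) ⟩
      (f zero + ∑ m (f ∘ suc)) + (g zero + ∑ m (g ∘ suc)) ∎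
    where open ≡-Reasoning

  ∑-swap : ∀ m p (F : Fin m → Fin p → ℕ) →
    ∑ m (λ x → ∑ p (F x)) ≡ ∑ p (λ y → ∑ m (λ x → F x y))
  ∑-swap zero    p F = sym (trans (∑-const p 0) (*-zeroʳ p))
  ∑-swap (suc m) p F = begin
      ∑ p (F zero) + ∑ m (λ x → ∑ p (F (suc x)))
    ≡⟨ cong (∑ p (F zero) +_) (∑-swap m p (F ∘ suc)) ⟩
      ∑ p (F zero) + ∑ p (λ y → ∑ m (λ x → F (suc x) y))
    ≡⟨ sym (∑-+ p (F zero) _) ⟩
      ∑ p (λ y → F zero y + ∑ m (λ x → F (suc x) y)) ∎
    where open ≡-Reasoning

  ∑-term : ∀ m (h : Fin m → ℕ) x → h x ≤ ∑ m h
  ∑-term (suc m) h zero    = m≤m+n (h zero) _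
  ∑-term (suc m) h (suc x) = ≤-trans (∑-term m (h ∘ suc) x) (m≤n+m _ (h zero))

  ∑-selected : ∀ m (c B : ℕ) (F : Fin m → ℕ) → (∀ x → F x ≤ B) →
    ∑ m (λ x → if toℕ x ≡ᵇ c then F x else 0) ≤ B
  ∑-selected zero    c       B F le = z≤n
  ∑-selected (suc m) zero    B F le =
    subst (_≤ B) (sym (trans (cong (F zero +_) (trans (∑-const m 0) (*-zeroʳ m))) (+-identityʳ _))) (le zero)
  ∑-selected (suc m) (suc c) B F le = ∑-selected m c B (F ∘ suc) (le ∘ suc)

  Triple : ℕ → Set
  Triple m = Fin m × Fin m × Fin m

  ∑³ : (m : ℕ) → (Fin m → Fin m → Fin m → ℕ) → ℕ
  ∑³ m J = ∑ m λ e → ∑ m λ f → ∑ m λ g → J e f g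

  at : ∀ {m} {A : Set} → (Fin m → Fin m → Fin m → A) → Triple m → A
  at J (e , f , g) = J e f g

  ∑³-term : ∀ m (J : Fin m → Fin m → Fin m → ℕ) (t : Triple m) → at J t ≤ ∑³ m J
  ∑³-term m J (e , f , g) =
    ≤-trans (∑-term m (J e f) g) (≤-trans (∑-term m (λ f → ∑ m (J e f)) f)
      (∑-term m (λ e → ∑ m λ f → ∑ m (J e f)) e))

  ∑²-∑³ : ∀ q m (F : Fin q → Fin q → Fin m → Fin m → Fin m → ℕ) →
    ∑ q (λ a → ∑ q (λ b → ∑³ m (F a b))) ≡ ∑³ m (λ e f g → ∑ q (λ a → ∑ q (λ b → F a b e f g)))
  ∑²-∑³ q m F =
    trans (pull (λ a b e → ∑ m λ f → ∑ m (F a b e f)))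
      (∑-cong m (λ e → trans (pull (λ a b f → ∑ m (F a b e f)))
        (∑-cong m (λ f → pull (λ a b → F a b e f)))))
    where
      pull : ∀ (G : Fin q → Fin q → Fin m → ℕ) →
        ∑ q (λ a → ∑ q (λ b → ∑ m (G a b))) ≡ ∑ m (λ e → ∑ q (λ a → ∑ q (λ b → G a b e)))
      pull G = trans (∑-cong q (λ a → ∑-swap q m (G a))) (∑-swap q m (λ a e → ∑ q (λ b → G a b e)))

  ≡ᵇ-refl : ∀ x → (x ≡ᵇ x) ≡ true
  ≡ᵇ-refl x = Equivalence.to T-≡ (≡⇒≡ᵇ x x refl)

  count-witnesses : ∀ q m (J : Fin m → Fin m → Fin m → ℕ)
    (Φ : Fin q → Fin q → Triple m) (ψ : Triple m → ℕ × ℕ) →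
    (∀ a b → ψ (Φ a b) ≡ (toℕ a , toℕ b)) → (∀ a b → 1 ≤ at J (Φ a b)) →
    q * q ≤ ∑³ m J
  count-witnesses q m J Φ ψ decode positive = begin
      q * q
    ≡⟨ cong (q *_) (sym (*-identityʳ q)) ⟩
      q * (q * 1)
    ≡⟨ sym (∑-const q (q * 1)) ⟩
      ∑ q (λ _ → q * 1)
    ≡⟨ ∑-cong q (λ _ → sym (∑-const q 1)) ⟩
      ∑ q (λ a → ∑ q (λ b → 1))
    ≤⟨ ∑-mono q (λ a → ∑-mono q (λ b → ≤-trans (positive a b) (≤-reflexive (sym (witness a b))))) ⟩
      ∑ q (λ a → ∑ q (λ b → at (sel a b) (Φ a b)))
    ≤⟨ ∑-mono q (λ a → ∑-mono q (λ b → ∑³-term m (sel a b) (Φ a b))) ⟩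
      ∑ q (λ a → ∑ q (λ b → ∑³ m (sel a b)))
    ≡⟨ ∑²-∑³ q m sel ⟩
      ∑³ m (λ e f g → ∑ q (λ a → ∑ q (λ b → sel a b e f g)))
    ≤⟨ ∑-mono m (λ e → ∑-mono m (λ f → ∑-mono m (λ g → at-most-one e f g))) ⟩
      ∑³ m J ∎
    where
      open ≤-Reasoning
      sel : Fin q → Fin q → Fin m → Fin m → Fin m → ℕ
      sel a b e f g = if toℕ b ≡ᵇ proj₂ (ψ (e , f , g))
        then (if toℕ a ≡ᵇ proj₁ (ψ (e , f , g)) then J e f g else 0) else 0

      witness : ∀ a b → at (sel a b) (Φ a b) ≡ at J (Φ a b)
      witness a b rewrite decode a b | ≡ᵇ-refl (toℕ a) | ≡ᵇ-refl (toℕ b) = refl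

      at-most-one : ∀ e f g → ∑ q (λ a → ∑ q (λ b → sel a b e f g)) ≤ J e f g
      at-most-one e f g = ≤-trans
        (∑-mono q (λ a → ∑-selected q (proj₂ (ψ (e , f , g))) _ _ (λ b → ≤-refl)))
        (∑-selected q (proj₁ (ψ (e , f , g))) (J e f g) _ (λ a → ≤-refl))

module IntegerSigns where

  open import Data.Nat as ℕ using (zero)
  import Data.Nat.Properties as ℕP
  open import Data.Integer
  open import Data.Integer.Properties
  open import Data.Product using (_×_; _,_)
  open import Data.Sum using (_⊎_; inj₁; inj₂)
  open import Data.Empty using (⊥; ⊥-elim)
  open import Relation.Binary.PropositionalEquality
  open import Data.Integer.Tactic.RingSolver using (solve-∀)

  negative-product : ∀ x y → x * y < + 0 → (x < + 0 × + 0 < y) ⊎ (+ 0 < x × y < + 0)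
  negative-product (+ zero)  y          (+<+ ())
  negative-product +[1+ a ] (+ zero)   p rewrite *-zeroʳ (+[1+ a ]) with p
  ... | +<+ ()
  negative-product +[1+ a ] +[1+ b ]   (+<+ ())
  negative-product +[1+ a ] -[1+ b ]   p = inj₂ (+<+ (ℕ.s≤s ℕ.z≤n) , -<+)
  negative-product -[1+ a ] (+ zero)   p rewrite *-zeroʳ (-[1+ a ]) with p
  ... | +<+ ()
  negative-product -[1+ a ] +[1+ b ]   p = inj₁ (-<+ , +<+ (ℕ.s≤s ℕ.z≤n))
  negative-product -[1+ a ] -[1+ b ]   (+<+ ())

  neg*pos<0 : ∀ x y → x < + 0 → + 0 < y → x * y < + 0
  neg*pos<0 -[1+ a ] +[1+ b ] _ _ = -<+
  neg*pos<0 -[1+ a ] (+ zero) _ (+<+ ())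
  neg*pos<0 (+ _)    _        (+<+ ()) _

  pos*neg<0 : ∀ x y → + 0 < x → y < + 0 → x * y < + 0
  pos*neg<0 x y p q = subst (_< + 0) (*-comm y x) (neg*pos<0 y x q p)

  ∣x∣+∣y∣≡∣x-y∣ : ∀ x y → x * y < + 0 → ∣ x ∣ ℕ.+ ∣ y ∣ ≡ ∣ x - y ∣
  ∣x∣+∣y∣≡∣x-y∣ x y p with negative-product x y p
  ∣x∣+∣y∣≡∣x-y∣ -[1+ a ] +[1+ b ] p | inj₁ _           = cong ℕ.suc (ℕP.+-suc a b)
  ∣x∣+∣y∣≡∣x-y∣ (+ _)    _        p | inj₁ (+<+ () , _)
  ∣x∣+∣y∣≡∣x-y∣ -[1+ a ] (+ zero) p | inj₁ (_ , +<+ ())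
  ∣x∣+∣y∣≡∣x-y∣ -[1+ a ] -[1+ b ] p | inj₁ (_ , ())
  ∣x∣+∣y∣≡∣x-y∣ +[1+ a ] -[1+ b ] p | inj₂ _           = refl
  ∣x∣+∣y∣≡∣x-y∣ +[1+ a ] (+ _)    p | inj₂ (_ , +<+ ())
  ∣x∣+∣y∣≡∣x-y∣ (+ zero) _        p | inj₂ (+<+ () , _)
  ∣x∣+∣y∣≡∣x-y∣ -[1+ a ] _        p | inj₂ (() , _)

  0<∣x∣ : ∀ x y → x * y < + 0 → 0 ℕ.< ∣ x ∣
  0<∣x∣ x y p with negative-product x y p
  0<∣x∣ -[1+ a ]     y p | inj₁ _           = ℕ.s≤s ℕ.z≤n
  0<∣x∣ (+ _)        y p | inj₁ (+<+ () , _)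
  0<∣x∣ (+ ℕ.suc a)  y p | inj₂ _           = ℕ.s≤s ℕ.z≤n
  0<∣x∣ (+ zero)     y p | inj₂ (+<+ () , _)
  0<∣x∣ -[1+ a ]     y p | inj₂ (() , _)

  neg-∣∣-injective : ∀ x y → x < + 0 → y < + 0 → ∣ x ∣ ≡ ∣ y ∣ → x ≡ y
  neg-∣∣-injective -[1+ a ] -[1+ b ] _        _        refl = refl
  neg-∣∣-injective (+ _)    _        (+<+ ()) _        _
  neg-∣∣-injective -[1+ _ ] (+ _)    _        (+<+ ()) _

  pos-∣∣-injective : ∀ x y → + 0 < x → + 0 < y → ∣ x ∣ ≡ ∣ y ∣ → x ≡ y
  pos-∣∣-injective (+ a)    (+ b)    _  _  refl = refl
  pos-∣∣-injective -[1+ _ ] _        () _  _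
  pos-∣∣-injective (+ _)    -[1+ _ ] _  () _

  -- if x₁ < 0 < y₁ and y₂ < 0 < x₂ then x₁ - y₁ < 0 < x₂ - y₂
  opposite-offsets : ∀ x₁ y₁ x₂ y₂ → x₁ < + 0 → + 0 < y₁ → + 0 < x₂ → y₂ < + 0 →
    x₁ - y₁ ≢ x₂ - y₂
  opposite-offsets -[1+ a ] (+ ℕ.suc b) (+ ℕ.suc c) -[1+ d ] _ _ _ _ ()
  opposite-offsets -[1+ a ] (+ zero) _ _ _ (+<+ ()) _ _
  opposite-offsets _ _ (+ zero) _ _ _ (+<+ ()) _
  opposite-offsets (+ _) _ _ _ (+<+ ()) _ _ _
  opposite-offsets -[1+ a ] (+ ℕ.suc b) (+ ℕ.suc c) (+ _) _ _ _ (+<+ ())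
  opposite-offsets -[1+ a ] -[1+ b ] _ _ _ () _ _
  opposite-offsets _ _ -[1+ c ] _ _ _ () _

  -- Two negative products x₁y₁, x₂y₂ with x₁ - y₁ = x₂ - y₂: the first
  -- factors have the same sign, so equal absolute values force x₁ = x₂.
  same-offset-∣∣-injective : ∀ x₁ y₁ x₂ y₂ → x₁ * y₁ < + 0 → x₂ * y₂ < + 0 →
    x₁ - y₁ ≡ x₂ - y₂ → ∣ x₁ ∣ ≡ ∣ x₂ ∣ → x₁ ≡ x₂
  same-offset-∣∣-injective x₁ y₁ x₂ y₂ p₁ p₂ eq ab
    with negative-product x₁ y₁ p₁ | negative-product x₂ y₂ p₂
  ... | inj₁ (n₁ , _)  | inj₁ (n₂ , _)  = neg-∣∣-injective x₁ x₂ n₁ n₂ ab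
  ... | inj₂ (q₁ , _)  | inj₂ (q₂ , _)  = pos-∣∣-injective x₁ x₂ q₁ q₂ ab
  ... | inj₁ (n₁ , q₁) | inj₂ (q₂ , n₂) = ⊥-elim (opposite-offsets x₁ y₁ x₂ y₂ n₁ q₁ q₂ n₂ eq)
  ... | inj₂ (q₁ , n₁) | inj₁ (n₂ , q₂) = ⊥-elim (opposite-offsets x₂ y₂ x₁ y₁ n₂ q₂ q₁ n₁ (sym eq))

  a-[a+1+d]<0 : ∀ a d → + a - + (a ℕ.+ ℕ.suc d) < + 0
  a-[a+1+d]<0 a d = subst (_< + 0) (sym (lem (+ a) (+ ℕ.suc d))) -<+
    where lem : ∀ x y → x - (x + y) ≡ - y
          lem = solve-∀

  0<[a+1+d]-a : ∀ a d → + 0 < + (a ℕ.+ ℕ.suc d) - + a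
  0<[a+1+d]-a a d = subst (+ 0 <_) (sym (lem (+ a) (+ ℕ.suc d))) (+<+ (ℕ.s≤s ℕ.z≤n))
    where lem : ∀ x y → (x + y) - x ≡ y
          lem = solve-∀

  ∣a-[a+d]∣ : ∀ a d → ∣ + a - + (a ℕ.+ d) ∣ ≡ d
  ∣a-[a+d]∣ a d = trans (cong ∣_∣ (lem (+ a) (+ d))) (∣-i∣≡∣i∣ (+ d))
    where lem : ∀ x y → x - (x + y) ≡ - y
          lem = solve-∀

  ∣[a+d]-a∣ : ∀ a d → ∣ + (a ℕ.+ d) - + a ∣ ≡ d
  ∣[a+d]-a∣ a d = cong ∣_∣ (lem (+ a) (+ d))
    where lem : ∀ x y → (x + y) - x ≡ y
          lem = solve-∀

  sub-cancelʳ : ∀ x y z → x - z ≡ y - z → x ≡ y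
  sub-cancelʳ x y z eq = trans (sym (lem x z)) (trans (cong (_+ z) eq) (lem y z))
    where lem : ∀ a b → (a - b) + b ≡ a
          lem = solve-∀

module Parity where

  open import Data.Nat
  open import Data.Nat.Properties using (≤-total; m+[n∸m]≡n)
  open import Data.Bool using (Bool; false; not; _xor_)
  open import Data.Bool.Properties using (not-distribˡ-xor; xor-same; xor-assoc; xor-comm)
  open import Data.Integer as ℤ using (+_; ∣_∣)
  open import Data.Integer.Properties using (∣i-j∣≡∣j-i∣)
  open import Data.Sum using (inj₁; inj₂)
  open import Relation.Binary.PropositionalEquality
  open import Data.Nat.Tactic.RingSolver using (solve-∀)
  open IntegerSigns using (∣a-[a+d]∣)

  odd : ℕ → Bool
  odd zero    = false
  odd (suc n) = not (odd n)

  odd-+ : ∀ a b → odd (a + b) ≡ odd a xor odd b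
  odd-+ zero    b = refl
  odd-+ (suc a) b = trans (cong not (odd-+ a b)) (not-distribˡ-xor (odd a) (odd b))

  odd-double : ∀ t → odd (t + t) ≡ false
  odd-double t = trans (odd-+ t t) (xor-same (odd t))

  odd-4*+ : ∀ p r → odd (4 * p + r) ≡ odd r
  odd-4*+ p r = begin
      odd (4 * p + r)
    ≡⟨ cong (λ z → odd (z + r)) (four p) ⟩
      odd ((2 * p + 2 * p) + r)
    ≡⟨ odd-+ (2 * p + 2 * p) r ⟩
      odd (2 * p + 2 * p) xor odd r
    ≡⟨ cong (_xor odd r) (odd-double (2 * p)) ⟩
      odd r ∎
    where
      open ≡-Reasoning
      four : ∀ p → 4 * p ≡ 2 * p + 2 * p
      four = solve-∀

  odd-distance-≤ : ∀ {a b} → a ≤ b → odd ∣ + a ℤ.- + b ∣ ≡ odd a xor odd b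
  odd-distance-≤ {a} {b} a≤b = begin
      odd ∣ + a ℤ.- + b ∣
    ≡⟨ cong (λ z → odd ∣ + a ℤ.- + z ∣) (sym (m+[n∸m]≡n a≤b)) ⟩
      odd ∣ + a ℤ.- + (a + (b ∸ a)) ∣
    ≡⟨ cong odd (∣a-[a+d]∣ a (b ∸ a)) ⟩
      odd (b ∸ a)
    ≡⟨ cong (_xor odd (b ∸ a)) (sym (xor-same (odd a))) ⟩
      (odd a xor odd a) xor odd (b ∸ a)
    ≡⟨ xor-assoc (odd a) (odd a) (odd (b ∸ a)) ⟩
      odd a xor (odd a xor odd (b ∸ a))
    ≡⟨ cong (odd a xor_) (sym (odd-+ a (b ∸ a))) ⟩
      odd a xor odd (a + (b ∸ a))
    ≡⟨ cong (λ z → odd a xor odd z) (m+[n∸m]≡n a≤b) ⟩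
      odd a xor odd b ∎
    where open ≡-Reasoning

  odd-distance : ∀ a b → odd ∣ + a ℤ.- + b ∣ ≡ odd a xor odd b
  odd-distance a b with ≤-total a b
  ... | inj₁ a≤b = odd-distance-≤ a≤b
  ... | inj₂ b≤a = begin
      odd ∣ + a ℤ.- + b ∣         ≡⟨ cong odd (∣i-j∣≡∣j-i∣ (+ a) (+ b)) ⟩
      odd ∣ + b ℤ.- + a ∣         ≡⟨ odd-distance-≤ b≤a ⟩
      odd b xor odd a             ≡⟨ xor-comm (odd b) (odd a) ⟩
      odd a xor odd b             ∎
    where open ≡-Reasoning

module NatFacts where

  open import Data.Nat
  open import Data.Nat.Properties
  open import Data.Nat.DivMod using (_%_; [m+kn]%n≡m%n; m<n⇒m%n≡m)
  open import Data.Product using (_×_; _,_)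
  open import Data.Sum using (_⊎_; inj₁; inj₂)
  open import Data.Empty using (⊥; ⊥-elim)
  open import Relation.Binary.PropositionalEquality
  open import Data.Nat.Tactic.RingSolver using (solve-∀)

  mod4-unique : ∀ p q r r′ → r < 4 → r′ < 4 → 4 * p + r ≡ 4 * q + r′ → r ≡ r′ × p ≡ q
  mod4-unique p q r r′ r<4 r′<4 eq =
    r≡r′ , *-cancelˡ-≡ p q 4 (+-cancelʳ-≡ r (4 * p) (4 * q) (trans eq (cong (4 * q +_) (sym r≡r′))))
    where
      residue : ∀ p r → r < 4 → (4 * p + r) % 4 ≡ r
      residue p r r<4 = begin
        (4 * p + r) % 4   ≡⟨ cong (_% 4) (trans (+-comm (4 * p) r) (cong (r +_) (*-comm 4 p))) ⟩
        (r + p * 4) % 4   ≡⟨ [m+kn]%n≡m%n r p 4 ⟩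
        r % 4             ≡⟨ m<n⇒m%n≡m r<4 ⟩
        r                 ∎
        where open ≡-Reasoning
      r≡r′ : r ≡ r′
      r≡r′ = trans (sym (residue p r r<4)) (trans (cong (_% 4) eq) (residue q r′ r′<4))

  nothing-between-adjacent : ∀ x y z → x < y → y < z → z ≡ suc x ⊎ x ≡ suc z → ⊥
  nothing-between-adjacent x y z p q (inj₁ refl) = <-irrefl refl (≤-trans q p)
  nothing-between-adjacent x y z p q (inj₂ refl) = <-asym (<-trans p q) (n<1+n z)

  *-positive : ∀ a b → 0 < a * b → 0 < a × 0 < b
  *-positive (suc a) (suc b) _ = s≤s z≤n , s≤s z≤n
  *-positive (suc a) zero p = ⊥-elim (<-irrefl (sym (*-zeroʳ a)) p)

  cancel-common-factor : ∀ c a b x y → 0 < c → a * (c * b) ≡ x * (c * y) → a * b ≡ x * y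
  cancel-common-factor c a b x y 0<c eq = *-cancelˡ-≡ (a * b) (x * y) c {{>-nonZero 0<c}}
    (trans (swap c a b) (trans eq (sym (swap c x y))))
    where swap : ∀ c a b → c * (a * b) ≡ a * (c * b)
          swap = solve-∀

module BooleanFacts where

  open import Data.Bool using (Bool; true; false; not; _∧_; _∨_; _xor_; if_then_else_)
  open import Data.Bool.ListAction using (and)
  open import Data.List using (List; []; _∷_; map)
  open import Data.Empty using (⊥; ⊥-elim)
  open import Relation.Nullary using (Dec; yes; no; ¬_)
  open import Relation.Nullary.Decidable using (⌊_⌋)
  open import Relation.Nullary.Negation using (contradiction)
  open import Relation.Binary.PropositionalEquality

  ⌊⌋-sound : ∀ {P : Set} (d : Dec P) → ⌊ d ⌋ ≡ true → P
  ⌊⌋-sound (yes p) _ = p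

  ⌊⌋-complete : ∀ {P : Set} (d : Dec P) → P → ⌊ d ⌋ ≡ true
  ⌊⌋-complete (yes _) _ = refl
  ⌊⌋-complete (no ¬p) p = contradiction p ¬p

  ⌊⌋-refute : ∀ {P : Set} (d : Dec P) → ¬ P → ⌊ d ⌋ ≡ false
  ⌊⌋-refute (yes p) ¬p = contradiction p ¬p
  ⌊⌋-refute (no _)  _  = refl

  -- a decision repeated in a conjunction, as in the crossing test
  both-true : ∀ {P : Set} (d : Dec P) → ⌊ d ⌋ ∧ ⌊ d ⌋ ≡ true → P
  both-true (yes p) _ = p

  and-all : ∀ {A : Set} (P : A → Bool) (xs : List A) → (∀ x → P x ≡ true) → and (map P xs) ≡ true
  and-all P []       all-true = refl
  and-all P (x ∷ xs) all-true = cong₂ _∧_ (all-true x) (and-all P xs all-true)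

  not-between : ∀ c b₁ b₂ b₃ b₄ → (c ≡ true → b₁ ≡ true → b₂ ≡ true → ⊥) →
    (c ≡ true → b₃ ≡ true → b₄ ≡ true → ⊥) → not (c ∧ ((b₁ ∧ b₂) ∨ (b₃ ∧ b₄))) ≡ true
  not-between false _     _     _     _     _  _  = refl
  not-between true  true  true  _     _     h₁ _  = ⊥-elim (h₁ refl refl refl)
  not-between true  _     _     true  true  _  h₂ = ⊥-elim (h₂ refl refl refl)
  not-between true  false _     false _     _  _  = refl
  not-between true  false _     true  false _  _  = refl
  not-between true  true  false false _     _  _  = refl
  not-between true  true  false true  false _  _  = refl

  first-of : ∀ {A : Set} → (A → Bool) → A → A → A → A
  first-of P x y z = if P x then x else (if P y then y else z)

  first-of-passes : ∀ {A : Set} (P : A → Bool) x y z → (P x ∨ (P y ∨ P z)) ≡ true →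
    P (first-of P x y z) ≡ true
  first-of-passes P x y z some = go (P x) refl (P y) refl some
    where
      go : ∀ b₁ → P x ≡ b₁ → ∀ b₂ → P y ≡ b₂ → (b₁ ∨ (b₂ ∨ P z)) ≡ true →
        P (if b₁ then x else (if b₂ then y else z)) ≡ true
      go true  px _     _  _  = px
      go false _  true  py _  = py
      go false _  false _  pz = pz

  first-of-preserves : ∀ {A : Set} (Q : A → Set) (P : A → Bool) x y z → Q x → Q y → Q z →
    Q (first-of P x y z)
  first-of-preserves Q P x y z qx qy qz with P x | P y
  ... | true  | _     = qx
  ... | false | true  = qy
  ... | false | false = qz

  -- Three pairwise crossing edges: if κ₁₂, κ₁₃, κ₂₃ say whether the first
  -- edge of each pair is on top, some edge is on top at one of its two
  -- crossings and below at the other.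
  triangle-switch : ∀ κ₁₂ κ₁₃ κ₂₃ →
    ((κ₁₂ xor κ₁₃) ∨ ((not κ₁₂ xor κ₂₃) ∨ (not κ₁₃ xor not κ₂₃))) ≡ true
  triangle-switch true  true  true  = refl
  triangle-switch true  true  false = refl
  triangle-switch true  false true  = refl
  triangle-switch true  false false = refl
  triangle-switch false true  true  = refl
  triangle-switch false true  false = refl
  triangle-switch false false true  = refl
  triangle-switch false false false = refl

module Construction where

  open import Data.Nat as ℕ using (ℕ; suc; _≤_; _<_; _<?_; z≤n; s≤s; _∸_)
  import Data.Nat.Properties as ℕP
  open import Data.Integer as ℤ using (ℤ; +_; -[1+_]; ∣_∣)
  import Data.Integer.Properties as ℤP
  open import Data.Fin using (Fin; toℕ; fromℕ<) renaming (_<?_ to _<ᶠ?_)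
  open import Data.Fin.Properties using (toℕ<n; toℕ-fromℕ<; toℕ-injective)
  open import Data.Product using (_×_; _,_; proj₁; proj₂; Σ)
  open import Data.Product.Properties using (,-injective)
  open import Data.Sum using (_⊎_; inj₁; inj₂; [_,_]′; swap)
  open import Data.Empty using (⊥; ⊥-elim)
  open import Data.Bool using (true; false; _∧_; _∨_; _xor_; not; if_then_else_)
  open import Data.List using ([]; _∷_; allFin)
  open import Data.Nat.Tactic.RingSolver using (solve)
  open import Relation.Nullary using (Dec; yes; no; ¬_)
  open import Relation.Nullary.Decidable using (⌊_⌋; map′)
  open import Function using (_∘_)
  open import Relation.Nullary.Negation using (contradiction)
  open import Relation.Binary.PropositionalEquality
  import Data.Nat.Tactic.RingSolver as ℕ-Solver
  import Data.Integer.Tactic.RingSolver as ℤ-Solver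
  open import Defs
  open Parity
  open IntegerSigns
  open NatFacts
  open FinSums
  open BooleanFacts

  -- The three families of edges: vertical, leaning right, leaning left.
  data Ty : Set where
    V Q R : Ty

  -- Residue modulo 4 of the x-coordinates of the endpoints of an edge of
  -- each type; residue 3 is reserved for the unused vertices.
  code : Ty → ℕ
  code V = 0
  code Q = 1
  code R = 2

  code<3 : ∀ t → code t < 3
  code<3 V = s≤s z≤n
  code<3 Q = s≤s (s≤s z≤n)
  code<3 R = s≤s (s≤s (s≤s z≤n))

  code-injective : ∀ {t t′} → code t ≡ code t′ → t ≡ t′
  code-injective {V} {V} _ = refl
  code-injective {Q} {Q} _ = refl
  code-injective {R} {R} _ = refl
  code-injective {V} {Q} ()
  code-injective {V} {R} ()
  code-injective {Q} {V} ()
  code-injective {Q} {R} ()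
  code-injective {R} {V} ()
  code-injective {R} {Q} ()

  -- Horizontal displacement from bottom to top endpoint, in units of E.
  σ : Ty → ℤ
  σ V = + 0
  σ Q = + 1
  σ R = -[1+ 0 ]

  gap : Ty → Ty → ℕ
  gap t t′ = ∣ σ t ℤ.- σ t′ ∣

  coordinate-injective : ∀ p p′ t t′ → 4 ℕ.* p ℕ.+ code t ≡ 4 ℕ.* p′ ℕ.+ code t′ → t ≡ t′ × p ≡ p′
  coordinate-injective p p′ t t′ eq
    with mod4-unique p p′ (code t) (code t′) (ℕP.m<n⇒m<1+n (code<3 t)) (ℕP.m<n⇒m<1+n (code<3 t′)) eq
  ... | same-code , same-quotient = code-injective same-code , same-quotient

  coordinate≢spare : ∀ p t v → 4 ℕ.* p ℕ.+ code t ≢ 4 ℕ.* v ℕ.+ 3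
  coordinate≢spare p t v eq =
    ℕP.<-irrefl (proj₁ (mod4-unique p v (code t) 3 (ℕP.m<n⇒m<1+n (code<3 t)) ℕP.≤-refl eq)) (code<3 t)

  _≟ᵗ_ : (t t′ : Ty) → Dec (t ≡ t′)
  t ≟ᵗ t′ = map′ code-injective (cong code) (code t ℕ.≟ code t′)

  parity-clash : ∀ a b → odd a ≡ true → odd b ≡ false → a ℕ.* 1 ≢ b ℕ.* 1
  parity-clash a b odd-a even-b eq = true≢false (begin
      true              ≡⟨ odd-a ⟨
      odd a             ≡⟨ cong odd (ℕP.*-cancelʳ-≡ a b 1 eq) ⟩
      odd b             ≡⟨ even-b ⟩
      false             ∎)
    where open ≡-Reasoning
          true≢false : true ≢ false
          true≢false ()

  double≢odd : ∀ a b → odd b ≡ true → a ℕ.* 2 ≢ b ℕ.* 1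
  double≢odd a b odd-b eq = parity-clash b (a ℕ.+ a) odd-b (odd-double a) (trans (sym eq) (twice a))
    where twice : ∀ a → a ℕ.* 2 ≡ (a ℕ.+ a) ℕ.* 1
          twice = ℕ-Solver.solve-∀

  -- Along an edge of type t, crossings with edges of two different types t₁, t₂
  -- lie at positions n₁/(E·gap t t₁) and n₂/(E·gap t t₂) whose numerators have
  -- parities fixed by the types; these positions never coincide.
  types-separate : ∀ t t₁ t₂ n₁ n₂ → t₁ ≢ t₂ → 0 < gap t t₁ → 0 < gap t t₂ →
    odd n₁ ≡ odd (code t₁) xor odd (code t) → odd n₂ ≡ odd (code t₂) xor odd (code t) →
    n₁ ℕ.* gap t t₂ ≢ n₂ ℕ.* gap t t₁
  types-separate V Q R n₁ n₂ _ _ _ p₁ p₂ = parity-clash n₁ n₂ p₁ p₂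
  types-separate V R Q n₁ n₂ _ _ _ p₁ p₂ = parity-clash n₂ n₁ p₂ p₁ ∘ sym
  types-separate Q V R n₁ n₂ _ _ _ p₁ p₂ = double≢odd n₁ n₂ p₂
  types-separate Q R V n₁ n₂ _ _ _ p₁ p₂ = double≢odd n₂ n₁ p₁ ∘ sym
  types-separate R V Q n₁ n₂ _ _ _ p₁ p₂ = double≢odd n₁ n₂ p₂
  types-separate R Q V n₁ n₂ _ _ _ p₁ p₂ = double≢odd n₂ n₁ p₁ ∘ sym
  types-separate V V _ _ _ _ () _
  types-separate Q Q _ _ _ _ () _
  types-separate R R _ _ _ _ () _
  types-separate V _ V _ _ _ _ ()
  types-separate Q _ Q _ _ _ _ ()
  types-separate R _ R _ _ _ _ ()
  types-separate _ V V _ _ t₁≢t₂ _ _ = ⊥-elim (t₁≢t₂ refl)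
  types-separate _ Q Q _ _ t₁≢t₂ _ _ = ⊥-elim (t₁≢t₂ refl)
  types-separate _ R R _ _ t₁≢t₂ _ _ = ⊥-elim (t₁≢t₂ refl)

  -- Along an edge of type t the crossing denominators E · gap t t′ all
  -- divide the common denominator E · mult t.
  mult : Ty → ℕ
  mult V = 1
  mult Q = 2
  mult R = 2

  0<mult : ∀ t → 0 < mult t
  0<mult V = s≤s z≤n
  0<mult Q = s≤s z≤n
  0<mult R = s≤s z≤n

  gap-divides : ∀ t t′ → 0 < gap t t′ → Σ ℕ λ c → gap t t′ ℕ.* c ≡ mult t
  gap-divides V Q _ = 1 , refl
  gap-divides V R _ = 1 , refl
  gap-divides Q V _ = 2 , refl
  gap-divides Q R _ = 1 , refl
  gap-divides R V _ = 2 , refl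
  gap-divides R Q _ = 1 , refl
  gap-divides V V ()
  gap-divides Q Q ()
  gap-divides R R ()

  orient-bottom : ∀ A B C → orient (A , + 0) (B , + 1) (C , + 0) ≡ A ℤ.- C
  orient-bottom = identity
    where identity : ∀ A B C → (B ℤ.- A) ℤ.* (+ 0 ℤ.- + 0) ℤ.- (+ 1 ℤ.- + 0) ℤ.* (C ℤ.- A) ≡ A ℤ.- C
          identity = ℤ-Solver.solve-∀

  orient-top : ∀ A B D → orient (A , + 0) (B , + 1) (D , + 1) ≡ B ℤ.- D
  orient-top = identity
    where identity : ∀ A B D → (B ℤ.- A) ℤ.* (+ 1 ℤ.- + 0) ℤ.- (+ 1 ℤ.- + 0) ℤ.* (D ℤ.- A) ≡ B ℤ.- D
          identity = ℤ-Solver.solve-∀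

  module Drawing (k n : ℕ) (12k≤n : 12 ℕ.* k ≤ n) where

    m E : ℕ
    m = 6 ℕ.* k
    E = 8 ℕ.* k

    opaque
      ty : ℕ → Ty
      ty e with e <? k | e <? k ℕ.+ k
      ... | yes _ | _     = V
      ... | no _  | yes _ = Q
      ... | no _  | no _  = R

      ty-V : ∀ {e} → e < k → ty e ≡ V
      ty-V {e} e<k with e <? k
      ... | yes _  = refl
      ... | no e≮k = contradiction e<k e≮k

      ty-Q : ∀ {e} → k ≤ e → e < k ℕ.+ k → ty e ≡ Q
      ty-Q {e} k≤e e<2k with e <? k | e <? k ℕ.+ k
      ... | yes e<k | _      = contradiction e<k (ℕP.≤⇒≯ k≤e)
      ... | no _    | yes _  = refl
      ... | no _    | no e≮2k = contradiction e<2k e≮2k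

      ty-R : ∀ {e} → k ℕ.+ k ≤ e → ty e ≡ R
      ty-R {e} 2k≤e with e <? k | e <? k ℕ.+ k
      ... | yes e<k | _       = contradiction e<k (ℕP.≤⇒≯ (ℕP.≤-trans (ℕP.m≤m+n k k) 2k≤e))
      ... | no _    | yes e<2k = contradiction e<2k (ℕP.≤⇒≯ 2k≤e)
      ... | no _    | no _    = refl

      R⇒k≤ : ∀ {e} → ty e ≡ R → k ≤ e
      R⇒k≤ {e} eq with e <? k
      R⇒k≤ {e} () | yes _
      ... | no e≮k = ℕP.≮⇒≥ e≮k

    bottom top : Ty → ℕ → ℕ
    bottom V e = e ℕ.+ 3 ℕ.* k
    bottom Q e = e ℕ.+ k
    bottom R e = e ℕ.+ k
    top V e = e ℕ.+ 3 ℕ.* k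
    top Q e = e ℕ.+ 3 ℕ.* k
    top R e = e ∸ k

    xb xt : ℕ → ℕ
    xb e = 4 ℕ.* bottom (ty e) e ℕ.+ code (ty e)
    xt e = 4 ℕ.* top (ty e) e ℕ.+ code (ty e)

    top-shift : ∀ t e → (t ≡ R → k ≤ e) →
      + (4 ℕ.* top t e ℕ.+ code t) ≡ + (4 ℕ.* bottom t e ℕ.+ code t) ℤ.+ + E ℤ.* σ t
    top-shift V e _ = sym (trans (cong (λ z → + x ℤ.+ z) (ℤP.*-zeroʳ (+ E))) (ℤP.+-identityʳ (+ x)))
      where x : ℕ
            x = 4 ℕ.* (e ℕ.+ 3 ℕ.* k) ℕ.+ 0
    top-shift Q e _ = trans (cong +_ (shift e k))
      (cong (λ z → + (4 ℕ.* (e ℕ.+ k) ℕ.+ 1) ℤ.+ z) (sym (ℤP.*-identityʳ (+ E))))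
      where shift : ∀ e k → 4 ℕ.* (e ℕ.+ 3 ℕ.* k) ℕ.+ 1 ≡ 4 ℕ.* (e ℕ.+ k) ℕ.+ 1 ℕ.+ 8 ℕ.* k
            shift = ℕ-Solver.solve-∀
    top-shift R e leans-left = begin
        + (4 ℕ.* (e ∸ k) ℕ.+ 2)
      ≡⟨ add-sub (+ (4 ℕ.* (e ∸ k) ℕ.+ 2)) (+ E) ⟩
        + (4 ℕ.* (e ∸ k) ℕ.+ 2 ℕ.+ E) ℤ.+ ℤ.- + E
      ≡⟨ cong (λ z → + z ℤ.+ ℤ.- + E) (shift (e ∸ k) k) ⟩
        + (4 ℕ.* (e ∸ k ℕ.+ k ℕ.+ k) ℕ.+ 2) ℤ.+ ℤ.- + E
      ≡⟨ cong (λ z → + (4 ℕ.* (z ℕ.+ k) ℕ.+ 2) ℤ.+ ℤ.- + E) (ℕP.m∸n+n≡m (leans-left refl)) ⟩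
        + (4 ℕ.* (e ℕ.+ k) ℕ.+ 2) ℤ.+ ℤ.- + E
      ≡⟨ cong (λ z → + (4 ℕ.* (e ℕ.+ k) ℕ.+ 2) ℤ.+ z) negate ⟩
        + (4 ℕ.* (e ℕ.+ k) ℕ.+ 2) ℤ.+ + E ℤ.* -[1+ 0 ] ∎
      where
        open ≡-Reasoning
        add-sub : ∀ a b → a ≡ (a ℤ.+ b) ℤ.+ ℤ.- b
        add-sub = ℤ-Solver.solve-∀
        shift : ∀ d k → 4 ℕ.* d ℕ.+ 2 ℕ.+ 8 ℕ.* k ≡ 4 ℕ.* (d ℕ.+ k ℕ.+ k) ℕ.+ 2
        shift = ℕ-Solver.solve-∀
        negate : ℤ.- + E ≡ + E ℤ.* -[1+ 0 ]
        negate = trans (sym (ℤP.-1*i≡-i (+ E))) (ℤP.*-comm ℤ.-1ℤ (+ E))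

    xt-shift : ∀ e → + xt e ≡ + xb e ℤ.+ + E ℤ.* σ (ty e)
    xt-shift e = top-shift (ty e) e R⇒k≤

    bottom-injective : ∀ t {e f} → bottom t e ≡ bottom t f → e ≡ f
    bottom-injective V = ℕP.+-cancelʳ-≡ (3 ℕ.* k) _ _
    bottom-injective Q = ℕP.+-cancelʳ-≡ k _ _
    bottom-injective R = ℕP.+-cancelʳ-≡ k _ _

    top-injective : ∀ t {e f} → (t ≡ R → k ≤ e) → (t ≡ R → k ≤ f) → top t e ≡ top t f → e ≡ f
    top-injective V _ _ = ℕP.+-cancelʳ-≡ (3 ℕ.* k) _ _
    top-injective Q _ _ = ℕP.+-cancelʳ-≡ (3 ℕ.* k) _ _
    top-injective R k≤e k≤f = ℕP.∸-cancelʳ-≡ (k≤e refl) (k≤f refl)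

    xb-injective : ∀ {e f} → xb e ≡ xb f → e ≡ f
    xb-injective {e} {f} eq with coordinate-injective (bottom (ty e) e) (bottom (ty f) f) (ty e) (ty f) eq
    ... | same-ty , same-bottom =
      bottom-injective (ty e) (subst (λ t → bottom (ty e) e ≡ bottom t f) (sym same-ty) same-bottom)

    xt-injective : ∀ {e f} → xt e ≡ xt f → e ≡ f
    xt-injective {e} {f} eq with coordinate-injective (top (ty e) e) (top (ty f) f) (ty e) (ty f) eq
    ... | same-ty , same-top =
      top-injective (ty e) R⇒k≤ (λ e-R → R⇒k≤ (trans (sym same-ty) e-R))
        (subst (λ t → top (ty e) e ≡ top t f) (sym same-ty) same-top)

    -- Vertices 0 … m-1 are the bottom endpoints of the edges, m … 2m-1 the
    -- top endpoints and the remaining ones are spare, placed far right.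
    opaque
      position : ℕ → Point
      position v with v <? m | v <? m ℕ.+ m
      ... | yes _ | _     = (+ xb v , + 0)
      ... | no _  | yes _ = (+ xt (v ∸ m) , + 1)
      ... | no _  | no _  = (+ (4 ℕ.* v ℕ.+ 3) , + 0)

      position-bottom : ∀ {v} → v < m → position v ≡ (+ xb v , + 0)
      position-bottom {v} v<m with v <? m
      ... | yes _  = refl
      ... | no v≮m = contradiction v<m v≮m

      position-upper : ∀ {v} → m ≤ v → v < m ℕ.+ m → position v ≡ (+ xt (v ∸ m) , + 1)
      position-upper {v} m≤v v<2m with v <? m | v <? m ℕ.+ m
      ... | yes v<m | _       = contradiction v<m (ℕP.≤⇒≯ m≤v)
      ... | no _    | yes _   = refl
      ... | no _    | no v≮2m = contradiction v<2m v≮2m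

      position-spare : ∀ {v} → m ℕ.+ m ≤ v → position v ≡ (+ (4 ℕ.* v ℕ.+ 3) , + 0)
      position-spare {v} 2m≤v with v <? m | v <? m ℕ.+ m
      ... | yes v<m  | _        = contradiction v<m (ℕP.≤⇒≯ (ℕP.≤-trans (ℕP.m≤m+n m m) 2m≤v))
      ... | no _     | yes v<2m = contradiction v<2m (ℕP.≤⇒≯ 2m≤v)
      ... | no _     | no _     = refl

      position-top : ∀ {e} → e < m → position (m ℕ.+ e) ≡ (+ xt e , + 1)
      position-top {e} e<m = trans (position-upper (ℕP.m≤m+n m e) (ℕP.+-monoʳ-< m e<m))
        (cong (λ z → (+ xt z , + 1)) (ℕP.m+n∸m≡n m e))

    data Placement (v : ℕ) : Set where
      at-bottom : v < m → position v ≡ (+ xb v , + 0) → Placement v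
      at-top    : m ≤ v → position v ≡ (+ xt (v ∸ m) , + 1) → Placement v
      spare     : position v ≡ (+ (4 ℕ.* v ℕ.+ 3) , + 0) → Placement v

    placement : ∀ v → Placement v
    placement v with v <? m | v <? m ℕ.+ m
    ... | yes v<m | _        = at-bottom v<m (position-bottom v<m)
    ... | no v≮m  | yes v<2m = at-top (ℕP.≮⇒≥ v≮m) (position-upper (ℕP.≮⇒≥ v≮m) v<2m)
    ... | no _    | no v≮2m  = spare (position-spare (ℕP.≮⇒≥ v≮2m))

    2m≤n : m ℕ.+ m ≤ n
    2m≤n = subst (_≤ n) (twelve k) 12k≤n
      where twelve : ∀ k → 12 ℕ.* k ≡ 6 ℕ.* k ℕ.+ 6 ℕ.* k
            twelve = ℕ-Solver.solve-∀

    -- edge e joins vertex e to vertex m + e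
    L : Layout n m
    L = record
      { pos = λ v → position (toℕ v)
      ; src = λ e → fromℕ< (ℕP.<-≤-trans (toℕ<n e) (ℕP.≤-trans (ℕP.m≤m+n m m) 2m≤n))
      ; tgt = λ e → fromℕ< (ℕP.<-≤-trans (ℕP.+-monoʳ-< m (toℕ<n e)) 2m≤n) }

    open Layout L using (src; tgt; pos)

    src-index : ∀ e → toℕ (src e) ≡ toℕ e
    src-index e = toℕ-fromℕ< _

    tgt-index : ∀ e → toℕ (tgt e) ≡ m ℕ.+ toℕ e
    tgt-index e = toℕ-fromℕ< _

    X Y : Fin m → ℤ
    X e = + xb (toℕ e)
    Y e = + xt (toℕ e)

    src-at : ∀ e → P₁ L e ≡ (X e , + 0)
    src-at e = trans (cong position (src-index e)) (position-bottom (toℕ<n e))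

    tgt-at : ∀ e → P₂ L e ≡ (Y e , + 1)
    tgt-at e = trans (cong position (tgt-index e)) (position-top (toℕ<n e))

    orient-edge : ∀ i p → orient (P₁ L i) (P₂ L i) p ≡ orient (X i , + 0) (Y i , + 1) p
    orient-edge i p = cong₂ (λ a b → orient a b p) (src-at i) (tgt-at i)

    orient-src : ∀ i j → orient (P₁ L i) (P₂ L i) (P₁ L j) ≡ X i ℤ.- X j
    orient-src i j = begin
        orient (P₁ L i) (P₂ L i) (P₁ L j)            ≡⟨ orient-edge i (P₁ L j) ⟩
        orient (X i , + 0) (Y i , + 1) (P₁ L j)      ≡⟨ cong (orient (X i , + 0) (Y i , + 1)) (src-at j) ⟩
        orient (X i , + 0) (Y i , + 1) (X j , + 0)   ≡⟨ orient-bottom (X i) (Y i) (X j) ⟩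
        X i ℤ.- X j                                 ∎
      where open ≡-Reasoning

    orient-tgt : ∀ i j → orient (P₁ L i) (P₂ L i) (P₂ L j) ≡ Y i ℤ.- Y j
    orient-tgt i j = begin
        orient (P₁ L i) (P₂ L i) (P₂ L j)            ≡⟨ orient-edge i (P₂ L j) ⟩
        orient (X i , + 0) (Y i , + 1) (P₂ L j)      ≡⟨ cong (orient (X i , + 0) (Y i , + 1)) (tgt-at j) ⟩
        orient (X i , + 0) (Y i , + 1) (Y j , + 1)   ≡⟨ orient-top (X i) (Y i) (Y j) ⟩
        Y i ℤ.- Y j                                 ∎
      where open ≡-Reasoning

    Δb Δt : Fin m → Fin m → ℤ
    Δb e f = X f ℤ.- X e
    Δt e f = Y f ℤ.- Y e

    num-formula : ∀ e f → num L e f ≡ ∣ Δb e f ∣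
    num-formula e f = cong ∣_∣ (orient-src f e)

    den-formula : ∀ e f → den L e f ≡ ∣ Δb e f ∣ ℕ.+ ∣ Δt e f ∣
    den-formula e f = cong₂ ℕ._+_ (cong ∣_∣ (orient-src f e)) (cong ∣_∣ (orient-tgt f e))

    crossing-criterion : ∀ e f →
      crosses L e f ≡ (⌊ Δb e f ℤ.* Δt e f ℤ.<? + 0 ⌋ ∧ ⌊ Δb e f ℤ.* Δt e f ℤ.<? + 0 ⌋)
    crossing-criterion e f = cong₂ (λ u v → ⌊ u ℤ.<? + 0 ⌋ ∧ ⌊ v ℤ.<? + 0 ⌋) sides-of-e sides-of-f
      where
        flip : ∀ a b c d → (a ℤ.- b) ℤ.* (c ℤ.- d) ≡ (b ℤ.- a) ℤ.* (d ℤ.- c)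
        flip = ℤ-Solver.solve-∀
        sides-of-e : orient (P₁ L e) (P₂ L e) (P₁ L f) ℤ.* orient (P₁ L e) (P₂ L e) (P₂ L f) ≡ Δb e f ℤ.* Δt e f
        sides-of-e = trans (cong₂ ℤ._*_ (orient-src e f) (orient-tgt e f)) (flip (X e) (X f) (Y e) (Y f))
        sides-of-f : orient (P₁ L f) (P₂ L f) (P₁ L e) ℤ.* orient (P₁ L f) (P₂ L f) (P₂ L e) ≡ Δb e f ℤ.* Δt e f
        sides-of-f = cong₂ ℤ._*_ (orient-src f e) (orient-tgt f e)

    crosses⇒ : ∀ e f → crosses L e f ≡ true → Δb e f ℤ.* Δt e f ℤ.< + 0
    crosses⇒ e f c = both-true (Δb e f ℤ.* Δt e f ℤ.<? + 0) (trans (sym (crossing-criterion e f)) c)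

    ⇒crosses : ∀ e f → Δb e f ℤ.* Δt e f ℤ.< + 0 → crosses L e f ≡ true
    ⇒crosses e f p = trans (crossing-criterion e f) (cong₂ _∧_ (⌊⌋-complete d p) (⌊⌋-complete d p))
      where d : Dec (Δb e f ℤ.* Δt e f ℤ.< + 0)
            d = Δb e f ℤ.* Δt e f ℤ.<? + 0

    tyE : Fin m → Ty
    tyE e = ty (toℕ e)

    offset-difference : ∀ e f → Δb e f ℤ.- Δt e f ≡ + E ℤ.* (σ (tyE e) ℤ.- σ (tyE f))
    offset-difference e f = begin
        (X f ℤ.- X e) ℤ.- (Y f ℤ.- Y e)
      ≡⟨ cong₂ (λ y y′ → (X f ℤ.- X e) ℤ.- (y ℤ.- y′)) (xt-shift (toℕ f)) (xt-shift (toℕ e)) ⟩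
        (X f ℤ.- X e) ℤ.- ((X f ℤ.+ + E ℤ.* σ (tyE f)) ℤ.- (X e ℤ.+ + E ℤ.* σ (tyE e)))
      ≡⟨ identity (X e) (X f) (σ (tyE e)) (σ (tyE f)) (+ E) ⟩
        + E ℤ.* (σ (tyE e) ℤ.- σ (tyE f))
      ∎
      where
        open ≡-Reasoning
        identity : ∀ a b s t E → (b ℤ.- a) ℤ.- ((b ℤ.+ E ℤ.* t) ℤ.- (a ℤ.+ E ℤ.* s)) ≡ E ℤ.* (s ℤ.- t)
        identity = ℤ-Solver.solve-∀

    den-crossing : ∀ e f → crosses L e f ≡ true → den L e f ≡ E ℕ.* gap (tyE e) (tyE f)
    den-crossing e f c = begin
        den L e f                                   ≡⟨ den-formula e f ⟩
        ∣ Δb e f ∣ ℕ.+ ∣ Δt e f ∣                     ≡⟨ ∣x∣+∣y∣≡∣x-y∣ (Δb e f) (Δt e f) (crosses⇒ e f c) ⟩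
        ∣ Δb e f ℤ.- Δt e f ∣                        ≡⟨ cong ∣_∣ (offset-difference e f) ⟩
        ∣ + E ℤ.* (σ (tyE e) ℤ.- σ (tyE f)) ∣        ≡⟨ ℤP.abs-* (+ E) _ ⟩
        E ℕ.* gap (tyE e) (tyE f)                   ∎
      where open ≡-Reasoning

    den-positive : ∀ e f → crosses L e f ≡ true → 0 < den L e f
    den-positive e f c = begin-strict
        0                          <⟨ 0<∣x∣ (Δb e f) (Δt e f) (crosses⇒ e f c) ⟩
        ∣ Δb e f ∣                  ≤⟨ ℕP.m≤m+n ∣ Δb e f ∣ ∣ Δt e f ∣ ⟩
        ∣ Δb e f ∣ ℕ.+ ∣ Δt e f ∣     ≡⟨ den-formula e f ⟨
        den L e f                  ∎
      where open ℕP.≤-Reasoning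

    crossing-positive : ∀ e f → crosses L e f ≡ true → 0 < E × 0 < gap (tyE e) (tyE f)
    crossing-positive e f c = *-positive E _ (subst (0 <_) (den-crossing e f c) (den-positive e f c))

    odd-num : ∀ e f → odd (num L e f) ≡ odd (code (tyE f)) xor odd (code (tyE e))
    odd-num e f = begin
        odd (num L e f)                                 ≡⟨ cong odd (num-formula e f) ⟩
        odd ∣ X f ℤ.- X e ∣                              ≡⟨ odd-distance (xb (toℕ f)) (xb (toℕ e)) ⟩
        odd (xb (toℕ f)) xor odd (xb (toℕ e))            ≡⟨ cong₂ _xor_ (residue f) (residue e) ⟩
        odd (code (tyE f)) xor odd (code (tyE e))       ∎
      where
        open ≡-Reasoning
        residue : ∀ i → odd (xb (toℕ i)) ≡ odd (code (tyE i))
        residue i = odd-4*+ (bottom (tyE i) (toℕ i)) (code (tyE i))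

    -- Two edges of the same type are parallel, so they cannot cross e at the
    -- same distance from its bottom endpoint.
    same-type-distinct-positions : ∀ e f g → crosses L e f ≡ true → crosses L e g ≡ true →
      tyE f ≡ tyE g → num L e f ≡ num L e g → f ≡ g
    same-type-distinct-positions e f g cf cg same-ty same-num =
      toℕ-injective (xb-injective (ℤP.+-injective (sub-cancelʳ (X f) (X g) (X e) same-Δb)))
      where
        same-offset : Δb e f ℤ.- Δt e f ≡ Δb e g ℤ.- Δt e g
        same-offset = trans (offset-difference e f)
          (trans (cong (λ t → + E ℤ.* (σ (tyE e) ℤ.- σ t)) same-ty) (sym (offset-difference e g)))
        same-Δb : Δb e f ≡ Δb e g
        same-Δb = same-offset-∣∣-injective (Δb e f) (Δt e f) (Δb e g) (Δt e g)
          (crosses⇒ e f cf) (crosses⇒ e g cg) same-offset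
          (trans (sym (num-formula e f)) (trans same-num (num-formula e g)))

    -- Distinct edges f, g cross e at distinct points: by parity if their types
    -- differ, by parallelism if they agree.
    no-triple-crossing : ∀ e f g → f ≢ g → crosses L e f ≡ true → crosses L e g ≡ true →
      num L e f ℕ.* den L e g ≢ num L e g ℕ.* den L e f
    no-triple-crossing e f g f≢g cf cg eq = by-types (tyE f ≟ᵗ tyE g)
      where
        by-types : Dec (tyE f ≡ tyE g) → ⊥
        by-types (no tf≢tg) = types-separate (tyE e) (tyE f) (tyE g) (num L e f) (num L e g) tf≢tg
          (proj₂ (crossing-positive e f cf)) (proj₂ (crossing-positive e g cg)) (odd-num e f) (odd-num e g)
          (cancel-common-factor E (num L e f) (gap (tyE e) (tyE g)) (num L e g) (gap (tyE e) (tyE f))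
            (proj₁ (crossing-positive e f cf))
            (subst₂ (λ x y → num L e f ℕ.* x ≡ num L e g ℕ.* y) (den-crossing e g cg) (den-crossing e f cf) eq))
        by-types (yes tf≡tg) = f≢g (same-type-distinct-positions e f g cf cg tf≡tg same-num)
          where
            same-den : den L e g ≡ den L e f
            same-den = trans (den-crossing e g cg)
              (trans (cong (λ t → E ℕ.* gap (tyE e) t) (sym tf≡tg)) (sym (den-crossing e f cf)))
            same-num : num L e f ≡ num L e g
            same-num = ℕP.*-cancelʳ-≡ (num L e f) (num L e g) (den L e f) {{ℕ.>-nonZero (den-positive e f cf)}}
              (trans (cong (num L e f ℕ.*_) (sym same-den)) eq)

    position-injective : ∀ a b → position a ≡ position b → a ≡ b
    position-injective a b eq = by-placement (placement a) (placement b)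
      where
        x-meet : ∀ {x x′ y y′} → position a ≡ (+ x , y) → position b ≡ (+ x′ , y′) → x ≡ x′
        x-meet pa pb = ℤP.+-injective (proj₁ (,-injective (trans (sym pa) (trans eq pb))))
        y-meet : ∀ {x x′ y y′} → position a ≡ (x , y) → position b ≡ (x′ , y′) → y ≡ y′
        y-meet pa pb = proj₂ (,-injective (trans (sym pa) (trans eq pb)))
        0≢1 : + 0 ≢ + 1
        0≢1 ()
        by-placement : Placement a → Placement b → a ≡ b
        by-placement (at-bottom _ pa)  (at-bottom _ pb) = xb-injective (x-meet pa pb)
        by-placement (at-bottom _ pa)  (at-top _ pb)    = contradiction (y-meet pa pb) 0≢1
        by-placement (at-bottom _ pa)  (spare pb)       =
          contradiction (x-meet pa pb) (coordinate≢spare (bottom (ty a) a) (ty a) b)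
        by-placement (at-top _ pa)     (at-bottom _ pb) = contradiction (sym (y-meet pa pb)) 0≢1
        by-placement (at-top m≤a pa)   (at-top m≤b pb)  = ℕP.∸-cancelʳ-≡ m≤a m≤b (xt-injective (x-meet pa pb))
        by-placement (at-top _ pa)     (spare pb)       = contradiction (sym (y-meet pa pb)) 0≢1
        by-placement (spare pa)        (at-bottom _ pb) =
          contradiction (sym (x-meet pa pb)) (coordinate≢spare (bottom (ty b) b) (ty b) a)
        by-placement (spare pa)        (at-top _ pb)    = contradiction (y-meet pa pb) 0≢1
        by-placement (spare pa)        (spare pb)       =
          proj₂ (mod4-unique a b 3 3 ℕP.≤-refl ℕP.≤-refl (x-meet pa pb))

    pos-injective : ∀ u v → pos u ≡ pos v → u ≡ v
    pos-injective u v eq = toℕ-injective (position-injective (toℕ u) (toℕ v) eq)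

    collinear-bottom : ∀ i x → orient (P₁ L i) (P₂ L i) (x , + 0) ≡ + 0 → x ≡ X i
    collinear-bottom i x eq = sym (ℤP.i-j≡0⇒i≡j (X i) x
      (trans (sym (orient-bottom (X i) (Y i) x)) (trans (sym (orient-edge i (x , + 0))) eq)))

    collinear-top : ∀ i x → orient (P₁ L i) (P₂ L i) (x , + 1) ≡ + 0 → x ≡ Y i
    collinear-top i x eq = sym (ℤP.i-j≡0⇒i≡j (Y i) x
      (trans (sym (orient-top (X i) (Y i) x)) (trans (sym (orient-edge i (x , + 1))) eq)))

    -- all vertices lie on y = 0 or y = 1, so a vertex on the line of an edge
    -- is one of its endpoints
    on-edge-line : ∀ v i → orient (P₁ L i) (P₂ L i) (pos v) ≡ + 0 → v ≡ src i ⊎ v ≡ tgt i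
    on-edge-line v i collinear = from (placement (toℕ v))
      where
        collinear-at : ∀ {p} → pos v ≡ p → orient (P₁ L i) (P₂ L i) p ≡ + 0
        collinear-at pv = subst (λ p → orient (P₁ L i) (P₂ L i) p ≡ + 0) pv collinear
        from : Placement (toℕ v) → v ≡ src i ⊎ v ≡ tgt i
        from (at-bottom _ pv) = inj₁ (pos-injective v (src i)
          (trans pv (trans (cong (_, + 0) (collinear-bottom i _ (collinear-at pv))) (sym (src-at i)))))
        from (at-top _ pv)    = inj₂ (pos-injective v (tgt i)
          (trans pv (trans (cong (_, + 1) (collinear-top i _ (collinear-at pv))) (sym (tgt-at i)))))
        from (spare pv)       = inj₁ (pos-injective v (src i)
          (trans pv (trans (cong (_, + 0) (collinear-bottom i _ (collinear-at pv))) (sym (src-at i)))))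

    -- bottom endpoints are vertices below m, top endpoints vertices from m on
    src≢tgt : ∀ i j → src i ≢ tgt j
    src≢tgt i j eq = ℕP.<⇒≢ (ℕP.<-≤-trans (toℕ<n i) (ℕP.m≤m+n m (toℕ j)))
      (trans (sym (src-index i)) (trans (cong toℕ eq) (tgt-index j)))

    src-injective : ∀ i j → src i ≡ src j → i ≡ j
    src-injective i j eq = toℕ-injective (trans (sym (src-index i)) (trans (cong toℕ eq) (src-index j)))


    is-drawing : IsDrawing L
    is-drawing = record
      { noLoop           = λ i → src≢tgt i i
      ; noMulti          = no-multi
      ; posInj           = pos-injective
      ; noVertexOnEdge   = λ v i v≢src v≢tgt collinear →
          ⊥-elim ([ v≢src , v≢tgt ]′ (on-edge-line v i collinear))
      ; noTripleCrossing = no-triple-crossing }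
      where
        no-multi : ∀ i j → i ≢ j →
          ¬ ((src i ≡ src j × tgt i ≡ tgt j) ⊎ (src i ≡ tgt j × tgt i ≡ src j))
        no-multi i j i≢j (inj₁ (same-src , _)) = i≢j (src-injective i j same-src)
        no-multi i j i≢j (inj₂ (src≡tgt , _))  = src≢tgt i j src≡tgt

    -- The crossing of e with f lies at the fraction K / M of the way along e.
    At : Fin m → Fin m → ℕ → ℕ → Set
    At e f K M = num L e f ℕ.* M ≡ K ℕ.* den L e f

    position-over : ∀ e h c M → den L e h ℕ.* c ≡ M → At e h (num L e h ℕ.* c) M
    position-over e h c M eq = begin
        num L e h ℕ.* M                     ≡⟨ cong (num L e h ℕ.*_) (sym eq) ⟩
        num L e h ℕ.* (den L e h ℕ.* c)     ≡⟨ reorder (num L e h) (den L e h) c ⟩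
        num L e h ℕ.* c ℕ.* den L e h       ∎
      where
        open ≡-Reasoning
        reorder : ∀ a d c → a ℕ.* (d ℕ.* c) ≡ a ℕ.* c ℕ.* d
        reorder = ℕ-Solver.solve-∀

    before-sound : ∀ e f g → before L e f g ≡ true → num L e f ℕ.* den L e g < num L e g ℕ.* den L e f
    before-sound e f g = ⌊⌋-sound (num L e f ℕ.* den L e g ℕ.<? num L e g ℕ.* den L e f)

    position-order : ∀ e f h K K′ M → 0 < M → At e f K M → At e h K′ M →
      before L e f h ≡ true → K < K′
    position-order e f h K K′ M 0<M at-f at-h f<h = ℕP.*-cancelʳ-< (den L e f ℕ.* den L e h) K K′ (begin-strict
        K ℕ.* (den L e f ℕ.* den L e h)         ≡⟨ ℕP.*-assoc K (den L e f) (den L e h) ⟨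
        K ℕ.* den L e f ℕ.* den L e h           ≡⟨ cong (ℕ._* den L e h) at-f ⟨
        num L e f ℕ.* M ℕ.* den L e h           ≡⟨ exchange (num L e f) M (den L e h) ⟩
        num L e f ℕ.* den L e h ℕ.* M           <⟨ ℕP.*-monoˡ-< M {{ℕ.>-nonZero 0<M}} (before-sound e f h f<h) ⟩
        num L e h ℕ.* den L e f ℕ.* M           ≡⟨ exchange (num L e h) (den L e f) M ⟩
        num L e h ℕ.* M ℕ.* den L e f           ≡⟨ cong (ℕ._* den L e f) at-h ⟩
        K′ ℕ.* den L e h ℕ.* den L e f          ≡⟨ exchange K′ (den L e h) (den L e f) ⟩
        K′ ℕ.* den L e f ℕ.* den L e h          ≡⟨ ℕP.*-assoc K′ (den L e f) (den L e h) ⟩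
        K′ ℕ.* (den L e f ℕ.* den L e h)        ∎)
      where
        open ℕP.≤-Reasoning
        exchange : ∀ a b c → a ℕ.* b ℕ.* c ≡ a ℕ.* c ℕ.* b
        exchange = ℕ-Solver.solve-∀

    adjacent⇒consecutive : ∀ e f g M K K′ → 0 < M →
      (∀ h → crosses L e h ≡ true → Σ ℕ λ c → den L e h ℕ.* c ≡ M) →
      At e f K M → At e g K′ M → K′ ≡ suc K ⊎ K ≡ suc K′ → consecutive L e f g ≡ true
    adjacent⇒consecutive e f g M K K′ 0<M divides at-f at-g adjacent =
      and-all _ (allFin m) λ h → not-between (crosses L e h) (before L e f h) (before L e h g)
        (before L e g h) (before L e h f)
        (λ c f<h h<g → nothing-between-adjacent K (Kₕ h c) K′
          (position-order e f h K (Kₕ h c) M 0<M at-f (placed h c) f<h)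
          (position-order e h g (Kₕ h c) K′ M 0<M (placed h c) at-g h<g) adjacent)
        (λ c g<h h<f → nothing-between-adjacent K′ (Kₕ h c) K
          (position-order e g h K′ (Kₕ h c) M 0<M at-g (placed h c) g<h)
          (position-order e h f (Kₕ h c) K M 0<M (placed h c) at-f h<f) (swap adjacent))
      where
        Kₕ : ∀ h → crosses L e h ≡ true → ℕ
        Kₕ h c = num L e h ℕ.* proj₁ (divides h c)
        placed : ∀ h (c : crosses L e h ≡ true) → At e h (Kₕ h c) M
        placed h c = position-over e h (proj₁ (divides h c)) M (proj₂ (divides h c))

    den-divides : ∀ e h c → crosses L e h ≡ true → gap (tyE e) (tyE h) ℕ.* c ≡ mult (tyE e) →
      den L e h ℕ.* c ≡ E ℕ.* mult (tyE e)
    den-divides e h c cr gap-c = begin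
        den L e h ℕ.* c                          ≡⟨ cong (ℕ._* c) (den-crossing e h cr) ⟩
        E ℕ.* gap (tyE e) (tyE h) ℕ.* c          ≡⟨ ℕP.*-assoc E (gap (tyE e) (tyE h)) c ⟩
        E ℕ.* (gap (tyE e) (tyE h) ℕ.* c)        ≡⟨ cong (E ℕ.*_) gap-c ⟩
        E ℕ.* mult (tyE e)                       ∎
      where open ≡-Reasoning

    consecutive-by-scales : ∀ e f g n n′ c c′ → crosses L e f ≡ true → crosses L e g ≡ true →
      num L e f ≡ n → num L e g ≡ n′ →
      gap (tyE e) (tyE f) ℕ.* c ≡ mult (tyE e) → gap (tyE e) (tyE g) ℕ.* c′ ≡ mult (tyE e) →
      n′ ℕ.* c′ ≡ suc (n ℕ.* c) ⊎ n ℕ.* c ≡ suc (n′ ℕ.* c′) → consecutive L e f g ≡ true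
    consecutive-by-scales e f g n n′ c c′ cf cg num-f num-g scale-f scale-g adjacent =
      adjacent⇒consecutive e f g (E ℕ.* mult (tyE e)) (n ℕ.* c) (n′ ℕ.* c′) 0<M common
        (subst (λ x → At e f (x ℕ.* c) (E ℕ.* mult (tyE e))) num-f
          (position-over e f c _ (den-divides e f c cf scale-f)))
        (subst (λ x → At e g (x ℕ.* c′) (E ℕ.* mult (tyE e))) num-g
          (position-over e g c′ _ (den-divides e g c′ cg scale-g)))
        adjacent
      where
        0<M : 0 < E ℕ.* mult (tyE e)
        0<M = ℕP.*-mono-≤ (proj₁ (crossing-positive e f cf)) (0<mult (tyE e))
        common : ∀ h → crosses L e h ≡ true → Σ ℕ λ c → den L e h ℕ.* c ≡ E ℕ.* mult (tyE e)
        common h ch = proj₁ scale , den-divides e h (proj₁ scale) ch (proj₂ scale)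
          where scale : Σ ℕ λ c → gap (tyE e) (tyE h) ℕ.* c ≡ mult (tyE e)
                scale = gap-divides (tyE e) (tyE h) (proj₂ (crossing-positive e h ch))

    crosses-rightward : ∀ e f d d′ → xb (toℕ f) ℕ.+ suc d ≡ xb (toℕ e) → xt (toℕ e) ℕ.+ suc d′ ≡ xt (toℕ f) →
      crosses L e f ≡ true
    crosses-rightward e f d d′ on-bottom on-top = ⇒crosses e f (neg*pos<0 (Δb e f) (Δt e f) Δb<0 0<Δt)
      where
        Δb<0 : Δb e f ℤ.< + 0
        Δb<0 = subst (λ z → + xb (toℕ f) ℤ.- + z ℤ.< + 0) on-bottom (a-[a+1+d]<0 (xb (toℕ f)) d)
        0<Δt : + 0 ℤ.< Δt e f
        0<Δt = subst (λ z → + 0 ℤ.< + z ℤ.- + xt (toℕ e)) on-top (0<[a+1+d]-a (xt (toℕ e)) d′)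

    crosses-leftward : ∀ e f d d′ → xb (toℕ e) ℕ.+ suc d ≡ xb (toℕ f) → xt (toℕ f) ℕ.+ suc d′ ≡ xt (toℕ e) →
      crosses L e f ≡ true
    crosses-leftward e f d d′ on-bottom on-top = ⇒crosses e f (pos*neg<0 (Δb e f) (Δt e f) 0<Δb Δt<0)
      where
        0<Δb : + 0 ℤ.< Δb e f
        0<Δb = subst (λ z → + 0 ℤ.< + z ℤ.- + xb (toℕ e)) on-bottom (0<[a+1+d]-a (xb (toℕ e)) d)
        Δt<0 : Δt e f ℤ.< + 0
        Δt<0 = subst (λ z → + xt (toℕ f) ℤ.- + z ℤ.< + 0) on-top (a-[a+1+d]<0 (xt (toℕ f)) d′)

    num-left : ∀ e f c → xb (toℕ f) ℕ.+ c ≡ xb (toℕ e) → num L e f ≡ c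
    num-left e f c on-bottom = trans (num-formula e f)
      (subst (λ z → ∣ + xb (toℕ f) ℤ.- + z ∣ ≡ c) on-bottom (∣a-[a+d]∣ (xb (toℕ f)) c))

    num-right : ∀ e f c → xb (toℕ e) ℕ.+ c ≡ xb (toℕ f) → num L e f ≡ c
    num-right e f c on-bottom = trans (num-formula e f)
      (subst (λ z → ∣ + z ℤ.- + xb (toℕ e) ∣ ≡ c) on-bottom (∣[a+d]-a∣ (xb (toℕ e)) c))

    bottom-coordinate : ∀ {e : Fin m} {i t} → toℕ e ≡ i → ty i ≡ t → xb (toℕ e) ≡ 4 ℕ.* bottom t i ℕ.+ code t
    bottom-coordinate refl refl = refl

    top-coordinate : ∀ {e : Fin m} {i t} → toℕ e ≡ i → ty i ≡ t → xt (toℕ e) ≡ 4 ℕ.* top t i ℕ.+ code t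
    top-coordinate refl refl = refl

    scale-for : ∀ {e f t t′} c → tyE e ≡ t → tyE f ≡ t′ → gap t t′ ℕ.* c ≡ mult t →
      gap (tyE e) (tyE f) ℕ.* c ≡ mult (tyE e)
    scale-for c refl refl eq = eq

    onTop-below : ∀ κ e f → toℕ e < toℕ f → onTop L κ e f ≡ κ e f
    onTop-below κ e f e<f = cong (λ b → if b then κ e f else not (κ f e)) (⌊⌋-complete (e <ᶠ? f) e<f)

    onTop-above : ∀ κ e f → toℕ f < toℕ e → onTop L κ e f ≡ not (κ f e)
    onTop-above κ e f f<e = cong (λ b → if b then κ e f else not (κ f e)) (⌊⌋-refute (e <ᶠ? f) (ℕP.<-asym f<e))

    switch-at : ∀ κ e f g → toℕ f < toℕ g → crosses L e f ≡ true → crosses L e g ≡ true →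
      consecutive L e f g ≡ true → isSwitch L κ e f g ≡ (onTop L κ e f xor onTop L κ e g)
    switch-at κ e f g f<g cf cg cfg = conjunction (⌊⌋-complete (f <ᶠ? g) f<g) cf cg cfg
      where
        conjunction : ∀ {b₁ b₂ b₃ b₄} {x} → b₁ ≡ true → b₂ ≡ true → b₃ ≡ true → b₄ ≡ true →
          (b₁ ∧ b₂ ∧ b₃ ∧ b₄ ∧ x) ≡ x
        conjunction refl refl refl refl = refl

    -- The pair (a, b) of a triangle can be read off any triple e, f, g
    -- describing a switch in it, according to the type of e.
    decode-by : Ty → Triple m → ℕ × ℕ
    decode-by V (e , f , g) = (toℕ e , toℕ f ∸ k)
    decode-by Q (e , f , g) = (toℕ f , toℕ e ∸ k)
    decode-by R (e , f , g) = (toℕ f , toℕ g ∸ k)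

    decode : Triple m → ℕ × ℕ
    decode t = decode-by (tyE (proj₁ t)) t

    -- For a + b < k, written k = 1 + a + b + w, the vertical edge a, the
    -- right-leaning edge k + b and the left-leaning edge 2k + 3a + w pairwise
    -- cross, and along each of them the two crossings are consecutive.
    module Triangle (a b w : ℕ) (k≡ : k ≡ suc (a ℕ.+ b ℕ.+ w)) where

      iV iQ iR : ℕ
      iV = a
      iQ = k ℕ.+ b
      iR = (3 ℕ.* a ℕ.+ w ℕ.+ k) ℕ.+ k

      a<k : a < k
      a<k = subst (a <_) (sym k≡) (s≤s (ℕP.≤-trans (ℕP.m≤m+n a b) (ℕP.m≤m+n (a ℕ.+ b) w)))

      iQ<2k : iQ < k ℕ.+ k
      iQ<2k = ℕP.+-monoʳ-< k (subst (b <_) (sym k≡) (s≤s (ℕP.≤-trans (ℕP.m≤n+m b a) (ℕP.m≤m+n (a ℕ.+ b) w))))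

      2k≤iR : k ℕ.+ k ≤ iR
      2k≤iR = ℕP.+-monoˡ-≤ k (ℕP.m≤n+m k (3 ℕ.* a ℕ.+ w))

      iV<iQ : iV < iQ
      iV<iQ = ℕP.<-≤-trans a<k (ℕP.m≤m+n k b)

      iQ<iR : iQ < iR
      iQ<iR = ℕP.<-≤-trans iQ<2k 2k≤iR

      iR<m : iR < m
      iR<m = subst (iR <_) sum (s≤s (ℕP.m≤m+n iR (a ℕ.+ 4 ℕ.* b ℕ.+ 3 ℕ.* w ℕ.+ 3)))
        where sum : suc (iR ℕ.+ (a ℕ.+ 4 ℕ.* b ℕ.+ 3 ℕ.* w ℕ.+ 3)) ≡ m
              sum rewrite k≡ = solve (a ∷ b ∷ w ∷ [])

      eV eQ eR : Fin m
      eV = fromℕ< (ℕP.<-trans iV<iQ (ℕP.<-trans iQ<iR iR<m))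
      eQ = fromℕ< (ℕP.<-trans iQ<iR iR<m)
      eR = fromℕ< iR<m

      ty-eV : tyE eV ≡ V
      ty-eV = trans (cong ty (toℕ-fromℕ< _)) (ty-V a<k)
      ty-eQ : tyE eQ ≡ Q
      ty-eQ = trans (cong ty (toℕ-fromℕ< _)) (ty-Q (ℕP.m≤m+n k b) iQ<2k)
      ty-eR : tyE eR ≡ R
      ty-eR = trans (cong ty (toℕ-fromℕ< _)) (ty-R 2k≤iR)

      cA cB cC dA dB dC : ℕ
      cA = 8 ℕ.* a ℕ.+ 4 ℕ.* w ℕ.+ 2
      cB = 8 ℕ.* a ℕ.+ 4 ℕ.* w ℕ.+ 1
      cC = 16 ℕ.* a ℕ.+ 8 ℕ.* w ℕ.+ 4
      dA = 8 ℕ.* b ℕ.+ 4 ℕ.* w ℕ.+ 4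
      dB = 8 ℕ.* b ℕ.+ 4 ℕ.* w ℕ.+ 5
      dC = 16 ℕ.* b ℕ.+ 8 ℕ.* w ℕ.+ 10

      -- at the bottom the order is eQ, eV, eR; at the top it is eR, eV, eQ
      QV-bottom : xb (toℕ eQ) ℕ.+ suc cA ≡ xb (toℕ eV)
      QV-bottom = subst₂ (λ u v → u ℕ.+ suc cA ≡ v)
        (sym (bottom-coordinate (toℕ-fromℕ< _) (ty-Q (ℕP.m≤m+n k b) iQ<2k)))
        (sym (bottom-coordinate (toℕ-fromℕ< _) (ty-V a<k))) identity
        where identity : 4 ℕ.* (iQ ℕ.+ k) ℕ.+ 1 ℕ.+ suc cA ≡ 4 ℕ.* (a ℕ.+ 3 ℕ.* k) ℕ.+ 0
              identity rewrite k≡ = solve (a ∷ b ∷ w ∷ [])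

      VR-bottom : xb (toℕ eV) ℕ.+ suc cB ≡ xb (toℕ eR)
      VR-bottom = subst₂ (λ u v → u ℕ.+ suc cB ≡ v)
        (sym (bottom-coordinate (toℕ-fromℕ< _) (ty-V a<k)))
        (sym (bottom-coordinate (toℕ-fromℕ< _) (ty-R 2k≤iR))) identity
        where identity : 4 ℕ.* (a ℕ.+ 3 ℕ.* k) ℕ.+ 0 ℕ.+ suc cB ≡ 4 ℕ.* (iR ℕ.+ k) ℕ.+ 2
              identity rewrite k≡ = solve (a ∷ b ∷ w ∷ [])

      QR-bottom : xb (toℕ eQ) ℕ.+ suc cC ≡ xb (toℕ eR)
      QR-bottom = subst₂ (λ u v → u ℕ.+ suc cC ≡ v)
        (sym (bottom-coordinate (toℕ-fromℕ< _) (ty-Q (ℕP.m≤m+n k b) iQ<2k)))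
        (sym (bottom-coordinate (toℕ-fromℕ< _) (ty-R 2k≤iR))) identity
        where identity : 4 ℕ.* (iQ ℕ.+ k) ℕ.+ 1 ℕ.+ suc cC ≡ 4 ℕ.* (iR ℕ.+ k) ℕ.+ 2
              identity rewrite k≡ = solve (a ∷ b ∷ w ∷ [])

      xt-eR : xt (toℕ eR) ≡ 4 ℕ.* (3 ℕ.* a ℕ.+ w ℕ.+ k) ℕ.+ 2
      xt-eR = trans (top-coordinate (toℕ-fromℕ< _) (ty-R 2k≤iR))
        (cong (λ z → 4 ℕ.* z ℕ.+ 2) (ℕP.m+n∸n≡m (3 ℕ.* a ℕ.+ w ℕ.+ k) k))

      VQ-top : xt (toℕ eV) ℕ.+ suc dA ≡ xt (toℕ eQ)
      VQ-top = subst₂ (λ u v → u ℕ.+ suc dA ≡ v)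
        (sym (top-coordinate (toℕ-fromℕ< _) (ty-V a<k)))
        (sym (top-coordinate (toℕ-fromℕ< _) (ty-Q (ℕP.m≤m+n k b) iQ<2k))) identity
        where identity : 4 ℕ.* (a ℕ.+ 3 ℕ.* k) ℕ.+ 0 ℕ.+ suc dA ≡ 4 ℕ.* (iQ ℕ.+ 3 ℕ.* k) ℕ.+ 1
              identity rewrite k≡ = solve (a ∷ b ∷ w ∷ [])

      RV-top : xt (toℕ eR) ℕ.+ suc dB ≡ xt (toℕ eV)
      RV-top = subst₂ (λ u v → u ℕ.+ suc dB ≡ v) (sym xt-eR)
        (sym (top-coordinate (toℕ-fromℕ< _) (ty-V a<k))) identity
        where identity : 4 ℕ.* (3 ℕ.* a ℕ.+ w ℕ.+ k) ℕ.+ 2 ℕ.+ suc dB ≡ 4 ℕ.* (a ℕ.+ 3 ℕ.* k) ℕ.+ 0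
              identity rewrite k≡ = solve (a ∷ b ∷ w ∷ [])

      RQ-top : xt (toℕ eR) ℕ.+ suc dC ≡ xt (toℕ eQ)
      RQ-top = subst₂ (λ u v → u ℕ.+ suc dC ≡ v) (sym xt-eR)
        (sym (top-coordinate (toℕ-fromℕ< _) (ty-Q (ℕP.m≤m+n k b) iQ<2k))) identity
        where identity : 4 ℕ.* (3 ℕ.* a ℕ.+ w ℕ.+ k) ℕ.+ 2 ℕ.+ suc dC ≡ 4 ℕ.* (iQ ℕ.+ 3 ℕ.* k) ℕ.+ 1
              identity rewrite k≡ = solve (a ∷ b ∷ w ∷ [])

      V×Q : crosses L eV eQ ≡ true
      V×Q = crosses-rightward eV eQ cA dA QV-bottom VQ-top
      V×R : crosses L eV eR ≡ true
      V×R = crosses-leftward eV eR cB dB VR-bottom RV-top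
      Q×V : crosses L eQ eV ≡ true
      Q×V = crosses-leftward eQ eV cA dA QV-bottom VQ-top
      Q×R : crosses L eQ eR ≡ true
      Q×R = crosses-leftward eQ eR cC dC QR-bottom RQ-top
      R×V : crosses L eR eV ≡ true
      R×V = crosses-rightward eR eV cB dB VR-bottom RV-top
      R×Q : crosses L eR eQ ≡ true
      R×Q = crosses-rightward eR eQ cC dC QR-bottom RQ-top

      -- along eV the crossings with eQ, eR lie at (1 + cA)/E and (1 + cB)/E
      consecutive-on-V : consecutive L eV eQ eR ≡ true
      consecutive-on-V = consecutive-by-scales eV eQ eR (suc cA) (suc cB) 1 1
        V×Q V×R
        (num-left eV eQ (suc cA) QV-bottom) (num-right eV eR (suc cB) VR-bottom)
        (scale-for 1 ty-eV ty-eQ refl) (scale-for 1 ty-eV ty-eR refl) (inj₂ adjacent)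
        where adjacent : suc (8 ℕ.* a ℕ.+ 4 ℕ.* w ℕ.+ 2) ℕ.* 1 ≡ suc (suc (8 ℕ.* a ℕ.+ 4 ℕ.* w ℕ.+ 1) ℕ.* 1)
              adjacent = solve (a ∷ w ∷ [])

      -- along eQ they lie at 2(1 + cA)/2E and (1 + cC)/2E
      consecutive-on-Q : consecutive L eQ eV eR ≡ true
      consecutive-on-Q = consecutive-by-scales eQ eV eR (suc cA) (suc cC) 2 1
        Q×V Q×R
        (num-right eQ eV (suc cA) QV-bottom) (num-right eQ eR (suc cC) QR-bottom)
        (scale-for 2 ty-eQ ty-eV refl) (scale-for 1 ty-eQ ty-eR refl) (inj₂ adjacent)
        where adjacent : suc (8 ℕ.* a ℕ.+ 4 ℕ.* w ℕ.+ 2) ℕ.* 2 ≡ suc (suc (16 ℕ.* a ℕ.+ 8 ℕ.* w ℕ.+ 4) ℕ.* 1)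
              adjacent = solve (a ∷ w ∷ [])

      -- along eR they lie at 2(1 + cB)/2E and (1 + cC)/2E
      consecutive-on-R : consecutive L eR eV eQ ≡ true
      consecutive-on-R = consecutive-by-scales eR eV eQ (suc cB) (suc cC) 2 1
        R×V R×Q
        (num-left eR eV (suc cB) VR-bottom) (num-left eR eQ (suc cC) QR-bottom)
        (scale-for 2 ty-eR ty-eV refl) (scale-for 1 ty-eR ty-eQ refl) (inj₁ adjacent)
        where adjacent : suc (16 ℕ.* a ℕ.+ 8 ℕ.* w ℕ.+ 4) ℕ.* 1 ≡ suc (suc (8 ℕ.* a ℕ.+ 4 ℕ.* w ℕ.+ 1) ℕ.* 2)
              adjacent = solve (a ∷ w ∷ [])

      T₁ T₂ T₃ : Triple m
      T₁ = (eV , eQ , eR)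
      T₂ = (eQ , eV , eR)
      T₃ = (eR , eV , eQ)

      index-V : toℕ eV ≡ iV
      index-V = toℕ-fromℕ< _
      index-Q : toℕ eQ ≡ iQ
      index-Q = toℕ-fromℕ< _
      index-R : toℕ eR ≡ iR
      index-R = toℕ-fromℕ< _

      V<Q : toℕ eV < toℕ eQ
      V<Q = subst₂ _<_ (sym index-V) (sym index-Q) iV<iQ
      Q<R : toℕ eQ < toℕ eR
      Q<R = subst₂ _<_ (sym index-Q) (sym index-R) iQ<iR
      V<R : toℕ eV < toℕ eR
      V<R = ℕP.<-trans V<Q Q<R

      some-switch : ∀ κ → (at (isSwitch L κ) T₁ ∨ (at (isSwitch L κ) T₂ ∨ at (isSwitch L κ) T₃)) ≡ true
      some-switch κ = trans (cong₂ _∨_ on-V (cong₂ _∨_ on-Q on-R)) (triangle-switch (κ eV eQ) (κ eV eR) (κ eQ eR))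
        where
          on-V : isSwitch L κ eV eQ eR ≡ (κ eV eQ xor κ eV eR)
          on-V = trans (switch-at κ eV eQ eR Q<R V×Q V×R consecutive-on-V)
                   (cong₂ _xor_ (onTop-below κ eV eQ V<Q) (onTop-below κ eV eR V<R))
          on-Q : isSwitch L κ eQ eV eR ≡ (not (κ eV eQ) xor κ eQ eR)
          on-Q = trans (switch-at κ eQ eV eR V<R Q×V Q×R consecutive-on-Q)
                   (cong₂ _xor_ (onTop-above κ eQ eV V<Q) (onTop-below κ eQ eR Q<R))
          on-R : isSwitch L κ eR eV eQ ≡ (not (κ eV eR) xor not (κ eQ eR))
          on-R = trans (switch-at κ eR eV eQ V<Q R×V R×Q consecutive-on-R)
                   (cong₂ _xor_ (onTop-above κ eR eV V<R) (onTop-above κ eR eQ Q<R))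

      witness : Casing L → Triple m
      witness κ = first-of (at (isSwitch L κ)) T₁ T₂ T₃

      witness-is-switch : ∀ κ → at (isSwitch L κ) (witness κ) ≡ true
      witness-is-switch κ = first-of-passes (at (isSwitch L κ)) T₁ T₂ T₃ (some-switch κ)

      witness-decodes : ∀ κ → decode (witness κ) ≡ (a , b)
      witness-decodes κ = first-of-preserves (λ t → decode t ≡ (a , b)) (at (isSwitch L κ)) T₁ T₂ T₃
        (trans (cong (λ t → decode-by t T₁) ty-eV) (cong₂ _,_ index-V Q-offset))
        (trans (cong (λ t → decode-by t T₂) ty-eQ) (cong₂ _,_ index-V Q-offset))
        (trans (cong (λ t → decode-by t T₃) ty-eR) (cong₂ _,_ index-V Q-offset))
        where Q-offset : toℕ eQ ∸ k ≡ b
              Q-offset = trans (cong (_∸ k) index-Q) (ℕP.m+n∸m≡n k b)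

    switches-as-∑³ : ∀ κ → switches L κ ≡ ∑³ m (λ e f g → toℕ' L (isSwitch L κ e f g))
    switches-as-∑³ κ = trans (sum-allFin m _) (∑-cong m λ e → trans (sum-allFin m _)
      (∑-cong m λ f → sum-allFin m (λ g → toℕ' L (isSwitch L κ e f g))))

    at-least-q²-switches : ∀ q → q ℕ.+ q ≤ k → (κ : Casing L) → q ℕ.* q ≤ switches L κ
    at-least-q²-switches q 2q≤k κ = subst (q ℕ.* q ≤_) (sym (switches-as-∑³ κ))
      (count-witnesses q m is-switch witness decode
        (λ a b → Triangle.witness-decodes (toℕ a) (toℕ b) (w a b) (k≡ a b) κ)
        (λ a b → subst (λ s → 1 ≤ toℕ' L s)
          (sym (Triangle.witness-is-switch (toℕ a) (toℕ b) (w a b) (k≡ a b) κ)) ℕP.≤-refl))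
      where
        is-switch : Fin m → Fin m → Fin m → ℕ
        is-switch e f g = toℕ' L (isSwitch L κ e f g)
        w : Fin q → Fin q → ℕ
        w a b = k ∸ suc (toℕ a ℕ.+ toℕ b)
        k≡ : ∀ a b → k ≡ suc (toℕ a ℕ.+ toℕ b ℕ.+ w a b)
        k≡ a b = sym (ℕP.m+[n∸m]≡n (ℕP.≤-trans (ℕP.+-mono-< (toℕ<n a) (toℕ<n b)) 2q≤k))
        witness : Fin q → Fin q → Triple m
        witness a b = Triangle.witness (toℕ a) (toℕ b) (w a b) (k≡ a b) κ

open import Defs
open import Data.Nat using (ℕ; _≤_; _*_)
open import Data.Product using (Σ; ∃-syntax; _×_)

module Sizes where

  open import Data.Nat
  open import Data.Nat.Properties
  open import Data.Nat.DivMod using (_/_; _%_; m≡m%n+[m/n]*n; m%n<n; m/n*n≤m; m≥n⇒m/n>0)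
  open import Data.Product using (_×_; _,_)
  open import Relation.Binary.PropositionalEquality
  open import Data.Nat.Tactic.RingSolver using (solve-∀)

  quotient-bounds : ∀ n → 24 ≤ n → 24 * (n / 24) ≤ n × n ≤ 48 * (n / 24)
  quotient-bounds n 24≤n = subst (_≤ n) (*-comm (n / 24) 24) (m/n*n≤m n 24) , (begin
      n                          ≡⟨ m≡m%n+[m/n]*n n 24 ⟩
      n % 24 + n / 24 * 24        ≤⟨ +-monoˡ-≤ (n / 24 * 24) (<⇒≤ (m%n<n n 24)) ⟩
      24 * 1 + n / 24 * 24        ≤⟨ +-monoˡ-≤ (n / 24 * 24) (*-monoʳ-≤ 24 (m≥n⇒m/n>0 24≤n)) ⟩
      24 * (n / 24) + n / 24 * 24 ≡⟨ double (n / 24) ⟩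
      48 * (n / 24)               ∎)
    where
      open ≤-Reasoning
      double : ∀ q → 24 * q + q * 24 ≡ 48 * q
      double = solve-∀

  quadratic-bound : ∀ n q s → n ≤ 48 * q → q * q ≤ s → n * n ≤ 2304 * s
  quadratic-bound n q s n≤48q q²≤s = begin
      n * n               ≤⟨ *-mono-≤ n≤48q n≤48q ⟩
      48 * q * (48 * q)   ≡⟨ square q ⟩
      2304 * (q * q)      ≤⟨ *-monoʳ-≤ 2304 q²≤s ⟩
      2304 * s            ∎
    where
      open ≤-Reasoning
      square : ∀ q → 48 * q * (48 * q) ≡ 2304 * (q * q)
      square = solve-∀

  edge-count : ∀ q n → 24 * q ≤ n → 6 * (q + q) ≤ 1 * n
  edge-count q n 24q≤n = subst₂ _≤_ (half q) (sym (*-identityˡ n))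
    (≤-trans (m≤m+n (12 * q) (12 * q)) (subst (_≤ n) (twice q) 24q≤n))
    where
      half : ∀ q → 12 * q ≡ 6 * (q + q)
      half = solve-∀
      twice : ∀ q → 24 * q ≡ 12 * q + 12 * q
      twice = solve-∀

  vertex-count : ∀ q n → 24 * q ≤ n → 12 * (q + q) ≤ n
  vertex-count q n = subst (_≤ n) (same q)
    where same : ∀ q → 24 * q ≡ 12 * (q + q)
          same = solve-∀

open Sizes
open Construction
open import Data.Nat using (_+_)
open import Data.Nat.DivMod using (_/_)
open import Data.Nat.Properties using (≤-refl)
open import Data.Product using (_,_; proj₁; proj₂)

-- For n ≥ 24 take q = ⌊n/24⌋ and the drawing with parameter k = 2q: it has
-- 12q ≤ n edges, and every casing has at least q² ≥ n²/2304 switches.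
lemma4 : ∃[ C ] ∃[ D ] ∃[ N ] ((n : ℕ) → N ≤ n →
    ∃[ m ] Σ (Layout n m) λ L → IsDrawing L × m ≤ C * n ×
    ((κ : Casing L) → n * n ≤ D * switches L κ))
lemma4 = 1 , 2304 , 24 , drawing
  where
    drawing : (n : ℕ) → 24 ≤ n → ∃[ m ] Σ (Layout n m) λ L → IsDrawing L × m ≤ 1 * n ×
      ((κ : Casing L) → n * n ≤ 2304 * switches L κ)
    drawing n 24≤n = m , L , is-drawing , edge-count q n 24q≤n , λ κ →
        quadratic-bound n q (switches L κ) (proj₂ (quotient-bounds n 24≤n)) (at-least-q²-switches q ≤-refl κ)
      where
        q : ℕ
        q = n / 24
        24q≤n : 24 * q ≤ n
        24q≤n = proj₁ (quotient-bounds n 24≤n)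
        open Drawing (q + q) n (vertex-count q n 24q≤n)
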